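{- For any signature $S$, the binary relation $\to$ on $T(S)$ is exactly the covering relation of the poset $(T(S),\preceq)$ (the $S$-easterly wind poset); that is, $t_1\to t_2$ holds if and only if $t_1\prec t_2$ and there is no $t_3$ with $t_1\prec t_3\prec t_2$.
   Context: A signature is a set $S$ with an arity map $|\cdot|:S\to\mathbb N$. An $S$-term is either the leaf $\ell$ or a tuple $s\,t_1\cdots t_{|s|}$ with $s\in S$ and $t_1,\dots,t_{|s|}$ $S$-terms (an ordered rooted tree whose internal nodes having $k$ children are decorated by elements of arity $k$); $T(S)$ is the set of $S$-terms. The preorder traversal of $s\,t_1\cdots t_k$ visits the root, then $t_1,\dots,t_k$ from left to right recursively. The internal nodes of an $S$-term $t$ are numbered $1,\dots,\deg t$ in preorder ($\deg t$ is the number of internal nodes) and identified with these numbers; $\mathrm{dc}(t)$ is the word of decorations of the internal nodes $1,\dots,\deg t$. The children of a node (leaves included) are numbered $1,2,\dots$ from left to right. An edge of $t$ is a triple $(i_1,j,i_2)$ of internal nodes with $i_2$ the $j$-th child of $i_1$; by convention, when $\deg t\ge 1$, $(1,0,1)$ is also an edge. Each internal node $i$ has a unique edge of the form $(i_1,j,i)$, its parent edge, and we write $\mathrm{pa}(i)=i_1$, $\mathrm{lp}(i)=j$. The connection word $\mathrm{cnc}(t)$ is the word of length $\deg t$ over $\mathbb Q$ with $\mathrm{cnc}(t)(i)=\mathrm{pa}(i)+1-2^{\mathrm{lp}(i)-a}$, where $a$ is the arity of the decoration of $\mathrm{pa}(i)$. The $S$-easterly wind order: $t_1\preceq t_2$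 iff $\mathrm{dc}(t_1)=\mathrm{dc}(t_2)$ and $\mathrm{cnc}(t_1)(i)\le\mathrm{cnc}(t_2)(i)$ for all internal nodes $i$. For $i\ge 1$, $t_1\to_i t_2$ holds when $t_1$ has degree at least $i$, the internal node $i$ of $t_1$ is visited immediately after some leaf $x$ in the preorder traversal of $t_1$, and $t_2$ is obtained from $t_1$ by detaching the subterm rooted at $i$ (a leaf taking its place) and grafting it in place of the leaf $x$. The relation $\to$ is the union of all $\to_i$, $i\ge1$. -}

module Defs where

open import Data.Nat using (ℕ; zero; suc; _+_; _*_; _∸_; _^_; _≤_)
open import Data.Nat.Properties using (m^n≢0)
open import Data.Integer using (+_)
open import Data.Rational as ℚ using (ℚ)
open import Data.List using (List; []; _∷_; _++_; length; map)
open import Data.List.Relation.Binary.Pointwise using (Pointwise)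
open import Data.Vec using (Vec; []; _∷_)
open import Data.Maybe using (Maybe; just; nothing)
open import Data.Product using (_×_; _,_; ∃; ∃-syntax; Σ)
open import Relation.Binary.PropositionalEquality using (_≡_; _≢_)
open import Relation.Nullary using (¬_)

record Signature : Set₁ where
  field
    Sym   : Set
    arity : Sym → ℕ
open Signature public

module _ (Sig : Signature) where

  data Term : Set where
    leaf : Term
    node : (s : Sym Sig) → Vec Term (arity Sig s) → Term

  -- Data of internal nodes in preorder: (decoration, pa, lp, arity of
  -- the decoration of pa).  Nodes are numbered 1,2,… in preorder.

  record NodeInfo : Set where
    constructor mkInfo
    field
      deco  : Sym Sig
      par   : ℕ
      lpos  : ℕ
      parAr : ℕ

  mutual
    -- walk p j a n t : infos of the internal nodes of t, where the root
    -- of t (if internal) gets number n and is the j-th child of node p,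
    -- whose decoration has arity a.
    walk : ℕ → ℕ → ℕ → ℕ → Term → List NodeInfo
    walk p j a n leaf = []
    walk p j a n (node s ts) = mkInfo s p j a ∷ walkCh n 1 (arity Sig s) (suc n) ts

    walkCh : ∀ {k} → ℕ → ℕ → ℕ → ℕ → Vec Term k → List NodeInfo
    walkCh p j a n [] = []
    walkCh p j a n (t ∷ ts) =
      walk p j a n t ++ walkCh p (suc j) a (n + length (walk p j a n t)) ts

  -- With the convention that (1,0,1) is the parent edge of the root.
  infos : Term → List NodeInfo
  infos leaf = []
  infos (node s ts) = walk 1 0 (arity Sig s) 1 (node s ts)

  dc : Term → List (Sym Sig)
  dc t = map NodeInfo.deco (infos t)

  -- pa + 1 - 2^(lp - a)  (with lp ≤ a), i.e. ((pa+1)·2^(a-lp) - 1) / 2^(a-lp)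
  cncValue : NodeInfo → ℚ
  cncValue (mkInfo _ p j a) =
    ℚ._/_ (+ ((suc p) * 2 ^ (a ∸ j) ∸ 1)) (2 ^ (a ∸ j)) {{m^n≢0 2 (a ∸ j)}}

  cnc : Term → List ℚ
  cnc t = map cncValue (infos t)

  _⪯_ : Term → Term → Set
  t₁ ⪯ t₂ = (dc t₁ ≡ dc t₂) × Pointwise ℚ._≤_ (cnc t₁) (cnc t₂)

  _≺_ : Term → Term → Set
  t₁ ≺ t₂ = (t₁ ⪯ t₂) × (t₁ ≢ t₂)

  Covers : Term → Term → Set
  Covers t₁ t₂ = (t₁ ≺ t₂) × ¬ (∃[ t₃ ] ((t₁ ≺ t₃) × (t₃ ≺ t₂)))

  -- Positions (paths of 0-based child indices) and preorder traversal.

  Path : Set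
  Path = List ℕ

  mutual
    positions : Term → List Path
    positions leaf = [] ∷ []
    positions (node s ts) = [] ∷ positionsCh 0 ts

    positionsCh : ∀ {k} → ℕ → Vec Term k → List Path
    positionsCh c [] = []
    positionsCh c (t ∷ ts) = map (c ∷_) (positions t) ++ positionsCh (suc c) ts

  mutual
    internalPositions : Term → List Path
    internalPositions leaf = []
    internalPositions (node s ts) = [] ∷ internalPositionsCh 0 ts

    internalPositionsCh : ∀ {k} → ℕ → Vec Term k → List Path
    internalPositionsCh c [] = []
    internalPositionsCh c (t ∷ ts) =
      map (c ∷_) (internalPositions t) ++ internalPositionsCh (suc c) ts

  nth : ∀ {A : Set} → List A → ℕ → Maybe A
  nth [] _ = nothing
  nth (x ∷ xs) zero = just x
  nth (x ∷ xs) (suc k) = nth xs k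

  -- position of the internal node number i (1-based)
  nodePos : Term → ℕ → Maybe Path
  nodePos t zero = nothing
  nodePos t (suc k) = nth (internalPositions t) k

  mutual
    subterm : Term → Path → Maybe Term
    subterm t [] = just t
    subterm leaf (_ ∷ _) = nothing
    subterm (node s ts) (c ∷ p) = subtermCh ts c p

    subtermCh : ∀ {k} → Vec Term k → ℕ → Path → Maybe Term
    subtermCh [] c p = nothing
    subtermCh (t ∷ ts) zero p = subterm t p
    subtermCh (t ∷ ts) (suc c) p = subtermCh ts c p

  mutual
    -- replace the subterm at a position by u (identity on invalid positions)
    replace : Term → Path → Term → Term
    replace t [] u = u
    replace leaf (_ ∷ _) u = leaf
    replace (node s ts) (c ∷ p) u = node s (replaceCh ts c p u)

    replaceCh : ∀ {k} → Vec Term k → ℕ → Path → Term → Vec Term k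
    replaceCh [] c p u = []
    replaceCh (t ∷ ts) zero p u = replace t p u ∷ ts
    replaceCh (t ∷ ts) (suc c) p u = t ∷ replaceCh ts c p u

  -- t₁ →ᵢ t₂: internal node i of t₁ (at position pᵢ) is visited immediately
  -- after a leaf x (at position pₓ); detach the subterm at pᵢ (leaving a leaf)
  -- and graft it in place of x.
  _⟶[_]_ : Term → ℕ → Term → Set
  t₁ ⟶[ i ] t₂ =
    Σ Path λ pₓ → Σ Path λ pᵢ → Σ (List Path) λ as → Σ (List Path) λ bs →
    Σ Term λ u →
      (nodePos t₁ i ≡ just pᵢ)
    × (positions t₁ ≡ as ++ (pₓ ∷ pᵢ ∷ bs))
    × (subterm t₁ pₓ ≡ just leaf)
    × (subterm t₁ pᵢ ≡ just u)
    × (t₂ ≡ replace (replace t₁ pᵢ leaf) pₓ u)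

  _⟶_ : Term → Term → Set
  t₁ ⟶ t₂ = ∃[ i ] ((1 ≤ i) × (t₁ ⟶[ i ] t₂))

-- Label every internal node by its decoration and its key (pa(i), a − lp(i)).
-- The connection value pa + 1 − 2^(lp − a) is a strictly increasing function of
-- the key ordered lexicographically, so ⪯ compares these labellings pointwise.
-- Reading the preorder word with a stack of the keys of the pending child slots
-- produces the labelling; the stack is strictly decreasing and the labelling
-- determines the word.  A move →ᵢ takes the leaf read just before node i to just
-- after the subterm of i: only the key of i changes, and it moves from one stack
-- entry to the next one up.  Any term strictly between would give node i a key
-- on the stack strictly between two adjacent entries, so a move is a cover.
-- Conversely, for a cover t₁ ≺ t₂ take the first node whose key increases: its
-- new key lies higher on the stack, so the leaf slot right above its old key can
-- be moved past it, giving t₁ → t′ ⪯ t₂, and t′ = t₂ because t₂ covers t₁.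

module Submission where

open import Defs
open import Data.Empty using (⊥-elim)
import Data.Integer as ℤ
import Data.Integer.Properties as ℤ
open import Data.List using (List; []; _∷_; _++_; length; map; replicate; drop; initLast; _∷ʳ′_)
import Data.List.Properties as List
open import Data.List.Properties
  using (∷-injective; ∷-injectiveˡ; ∷-injectiveʳ; ++-cancelˡ; length-map; map-id; map-++; map-∘; ++-assoc; length-++; ++-identityʳ)
open import Data.List.Membership.Propositional using (_∈_)
open import Data.List.Membership.Propositional.Properties using (∈-++⁺ʳ)
open import Data.List.Relation.Binary.Pointwise as Pointwise using (Pointwise; []; _∷_)
open import Data.List.Relation.Unary.All as All using (All; []; _∷_)
import Data.List.Relation.Unary.All.Properties as All
open import Data.List.Relation.Unary.AllPairs as AllPairs using (AllPairs; []; _∷_)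
import Data.List.Relation.Unary.AllPairs.Properties as AllPairs
open import Data.List.Relation.Unary.Any using (here; there)
open import Data.Maybe using (Maybe; just; nothing)
open import Data.Maybe.Properties using (just-injective)
open import Data.Nat as ℕ using (ℕ; zero; suc; _+_; _*_; _∸_; _^_; _<_; _≤_; s≤s; z≤n; NonZero)
import Data.Nat.Properties as ℕ
open import Data.Nat.Solver using (module +-*-Solver)
open import Data.Product using (_×_; _,_; proj₁; proj₂; ∃; ∃-syntax; Σ-syntax)
open import Data.Product.Properties using (≡-dec)
open import Data.Product.Relation.Binary.Lex.Strict using (×-Lex; ×-transitive; ×-asymmetric; ×-compare)
open import Data.Product.Relation.Binary.Pointwise.NonDependent using (≡×≡⇒≡)
open import Data.Rational as ℚ using (ℚ)
import Data.Rational.Properties as ℚ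
open import Data.Rational.Unnormalised using (mkℚᵘ; *<*)
import Data.Rational.Unnormalised.Properties as ℚᵘ
open import Data.Sum using (_⊎_; inj₁; inj₂)
open import Data.Vec using (Vec; []; _∷_)
open import Function using (case_of_; _∘_; id)
open import Relation.Binary using (Transitive; Asymmetric; Irreflexive; tri<; tri≈; tri>)
import Relation.Binary.Construct.StrictToNonStrict as NonStrict
open import Relation.Binary.PropositionalEquality
open import Relation.Nullary using (¬_; Dec; yes; no)

-- Slot keys and their connection values

Key : Set
Key = ℕ × ℕ

_<ₖ_ : Key → Key → Set
_<ₖ_ = ×-Lex _≡_ _<_ _<_

_≤ₖ_ : Key → Key → Set
_≤ₖ_ = NonStrict._≤_ _≡_ _<ₖ_

<ₖ-trans : Transitive _<ₖ_
<ₖ-trans = ×-transitive {_≈₁_ = _≡_} {_<₁_ = _<_} {_<₂_ = _<_} isEquivalence (resp₂ _<_) ℕ.<-trans ℕ.<-trans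

<ₖ-asym : Asymmetric _<ₖ_
<ₖ-asym = ×-asymmetric {_≈₁_ = _≡_} {_<₁_ = _<_} {_<₂_ = _<_} sym (resp₂ _<_) ℕ.<-asym ℕ.<-asym

<ₖ-irrefl : Irreflexive _≡_ _<ₖ_
<ₖ-irrefl refl κ<κ = <ₖ-asym κ<κ κ<κ

≤ₖ-antisym : ∀ {κ κ′} → κ ≤ₖ κ′ → κ′ ≤ₖ κ → κ ≡ κ′
≤ₖ-antisym = NonStrict.antisym _≡_ _<ₖ_ isEquivalence <ₖ-trans <ₖ-irrefl

<ₖ⇒≱ₖ : ∀ {κ κ′} → κ <ₖ κ′ → ¬ (κ′ ≤ₖ κ)
<ₖ⇒≱ₖ κ<κ′ (inj₁ κ′<κ) = <ₖ-asym κ<κ′ κ′<κ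
<ₖ⇒≱ₖ κ<κ′ (inj₂ refl) = <ₖ-irrefl refl κ<κ′

_≟ₖ_ : (κ κ′ : Key) → Dec (κ ≡ κ′)
_≟ₖ_ = ≡-dec ℕ._≟_ ℕ._≟_

-- The key (p , d) of a node i stands for pa(i) = p and a − lp(i) = d; its
-- connection value p + 1 − 2^(−d) is written as one fraction, exactly as in cncValue.
keyValue : Key → ℚ
keyValue (p , d) = ℚ._/_ (ℤ.+ (suc p * 2 ^ d ∸ 1)) (2 ^ d) {{ℕ.m^n≢0 2 d}}

private
  /-<-/ : ∀ m n m′ n′ .{{_ : NonZero n}} .{{_ : NonZero n′}} →
          m * n′ < m′ * n → ℚ._/_ (ℤ.+ m) n ℚ.< ℚ._/_ (ℤ.+ m′) n′
  /-<-/ m (suc n) m′ (suc n′) mn′<m′n = ℚ.toℚᵘ-cancel-<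
    (ℚᵘ.<-respʳ-≃ (ℚᵘ.≃-sym (ℚ.toℚᵘ-fromℚᵘ (mkℚᵘ (ℤ.+ m′) n′)))
      (ℚᵘ.<-respˡ-≃ (ℚᵘ.≃-sym (ℚ.toℚᵘ-fromℚᵘ (mkℚᵘ (ℤ.+ m) n)))
        (*<* (subst₂ ℤ._<_ (ℤ.pos-* m (suc n′)) (ℤ.pos-* m′ (suc n)) (ℤ.+<+ mn′<m′n)))))

  2^-suc : ∀ d → ∃ λ x → 2 ^ d ≡ suc x
  2^-suc d with 2 ^ d | ℕ.m^n>0 2 d
  ... | suc x | _ = x , refl

  open +-*-Solver

  -- With 2^d = x + 1 and 2^d′ = y + 1 the numerators are x + p (x + 1) and y + p′ (y + 1).
  cross-<-parent : ∀ p p′ x y → p < p′ → (x + p * suc x) * suc y < (y + p′ * suc y) * suc x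
  cross-<-parent p p′ x y p<p′ = begin-strict
      (x + p * suc x) * suc y   <⟨ ℕ.*-monoˡ-< (suc y) (ℕ.n<1+n (x + p * suc x)) ⟩
      suc p * suc x * suc y     ≤⟨ ℕ.*-monoˡ-≤ (suc y) (ℕ.*-monoˡ-≤ (suc x) p<p′) ⟩
      p′ * suc x * suc y        ≡⟨ solve 3 (λ p x y → p :* (con 1 :+ x) :* (con 1 :+ y) := p :* (con 1 :+ y) :* (con 1 :+ x)) refl p′ x y ⟩
      p′ * suc y * suc x        ≤⟨ ℕ.*-monoˡ-≤ (suc x) (ℕ.m≤n+m (p′ * suc y) y) ⟩
      (y + p′ * suc y) * suc x  ∎
    where open ℕ.≤-Reasoning

  cross-<-depth : ∀ p x y → x < y → (x + p * suc x) * suc y < (y + p * suc y) * suc x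
  cross-<-depth p x y x<y = ℕ.+-cancelʳ-< _ _ _ (begin-strict
      (x + p * suc x) * suc y + suc x  <⟨ ℕ.+-monoʳ-< _ (s≤s x<y) ⟩
      (x + p * suc x) * suc y + suc y  ≡⟨ solve 3 (λ p x y → (x :+ p :* (con 1 :+ x)) :* (con 1 :+ y) :+ (con 1 :+ y)
                                                           := (y :+ p :* (con 1 :+ y)) :* (con 1 :+ x) :+ (con 1 :+ x)) refl p x y ⟩
      (y + p * suc y) * suc x + suc x  ∎)
    where open ℕ.≤-Reasoning

keyValue-mono-< : ∀ {κ κ′} → κ <ₖ κ′ → keyValue κ ℚ.< keyValue κ′
keyValue-mono-< {p , d} {p′ , d′} κ<κ′ =
  /-<-/ (suc p * 2 ^ d ∸ 1) (2 ^ d) (suc p′ * 2 ^ d′ ∸ 1) (2 ^ d′) {{ℕ.m^n≢0 2 d}} {{ℕ.m^n≢0 2 d′}} (cross κ<κ′)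
  where
    cross : (p , d) <ₖ (p′ , d′) → (suc p * 2 ^ d ∸ 1) * 2 ^ d′ < (suc p′ * 2 ^ d′ ∸ 1) * 2 ^ d
    cross κ<κ′ with 2^-suc d | 2^-suc d′
    ... | x , 2^d≡ | y , 2^d′≡ rewrite 2^d≡ | 2^d′≡ with κ<κ′
    ... | inj₁ p<p′ = cross-<-parent p p′ x y p<p′
    ... | inj₂ (refl , d<d′) =
      cross-<-depth p x y (ℕ.≤-pred (subst₂ _<_ 2^d≡ 2^d′≡ (ℕ.^-monoʳ-< 2 (s≤s (s≤s z≤n)) d<d′)))

keyValue-mono-≤ : ∀ {κ κ′} → κ ≤ₖ κ′ → keyValue κ ℚ.≤ keyValue κ′
keyValue-mono-≤ (inj₁ κ<κ′) = ℚ.<⇒≤ (keyValue-mono-< κ<κ′)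
keyValue-mono-≤ (inj₂ refl) = ℚ.≤-refl

keyValue-cancel-≤ : ∀ {κ κ′} → keyValue κ ℚ.≤ keyValue κ′ → κ ≤ₖ κ′
keyValue-cancel-≤ {κ} {κ′} v≤v′ with ×-compare {_≈₁_ = _≡_} {_<₁_ = _<_} {_≈₂_ = _≡_} {_<₂_ = _<_} sym ℕ.<-cmp ℕ.<-cmp κ κ′
... | tri< κ<κ′ _ _ = inj₁ κ<κ′
... | tri≈ _ κ≈κ′ _ = inj₂ (≡×≡⇒≡ κ≈κ′)
... | tri> _ _ κ′<κ = ⊥-elim (ℚ.<-irrefl refl (ℚ.<-≤-trans (keyValue-mono-< κ′<κ) v≤v′))

Descending : List Key → Set
Descending = AllPairs (λ κ κ′ → κ′ <ₖ κ)

descending-suffix : ∀ M {R} → Descending (M ++ R) → Descending R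
descending-suffix [] desc = desc
descending-suffix (_ ∷ M) (_ ∷ desc) = descending-suffix M desc

∈-descending : ∀ M {a R κ} → Descending (M ++ a ∷ R) → κ ∈ M ++ a ∷ R → a <ₖ κ ⊎ κ ≡ a ⊎ κ ∈ R
∈-descending [] _ (here refl) = inj₂ (inj₁ refl)
∈-descending [] _ (there κ∈R) = inj₂ (inj₂ κ∈R)
∈-descending (_ ∷ M) (above ∷ _) (here refl) = inj₁ (All.lookup above (∈-++⁺ʳ M (here refl)))
∈-descending (_ ∷ M) (_ ∷ desc) (there κ∈) = ∈-descending M desc κ∈

between-neighbours : ∀ M {a b R κ} → Descending (M ++ a ∷ b ∷ R) → κ ∈ M ++ a ∷ b ∷ R →
                     b ≤ₖ κ → κ ≤ₖ a → κ ≡ a ⊎ κ ≡ b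
between-neighbours M desc κ∈ b≤κ κ≤a with ∈-descending M desc κ∈
... | inj₁ a<κ = ⊥-elim (<ₖ⇒≱ₖ a<κ κ≤a)
... | inj₂ (inj₁ κ≡a) = inj₁ κ≡a
... | inj₂ (inj₂ (here κ≡b)) = inj₂ κ≡b
... | inj₂ (inj₂ (there κ∈R)) =
  ⊥-elim (<ₖ⇒≱ₖ (All.lookup (AllPairs.head below-a) κ∈R) b≤κ)
  where
    below-a = descending-suffix (M ++ _ ∷ []) (subst Descending (sym (++-assoc M _ _)) desc)

last-above : ∀ L {κ₁ R κ₂} → Descending (L ++ κ₁ ∷ R) → κ₂ ∈ L ++ κ₁ ∷ R → κ₁ <ₖ κ₂ →
             Σ[ L′ ∈ List Key ] Σ[ l ∈ Key ] L ≡ L′ ++ l ∷ [] × l ≤ₖ κ₂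
last-above L desc κ₂∈ κ₁<κ₂ with initLast L
last-above .[] (below ∷ _) κ₂∈ κ₁<κ₂ | [] with κ₂∈
... | here refl = ⊥-elim (<ₖ-irrefl refl κ₁<κ₂)
... | there κ₂∈R = ⊥-elim (<ₖ-asym κ₁<κ₂ (All.lookup below κ₂∈R))
last-above .(L′ ++ l ∷ []) {κ₁} {R} desc κ₂∈ κ₁<κ₂ | L′ ∷ʳ′ l
  with ∈-descending L′ (subst Descending (++-assoc L′ _ _) desc) (subst (_ ∈_) (++-assoc L′ _ _) κ₂∈)
... | inj₁ l<κ₂ = L′ , l , refl , inj₁ l<κ₂
... | inj₂ (inj₁ κ₂≡l) = L′ , l , refl , inj₂ (sym κ₂≡l)
... | inj₂ (inj₂ (here refl)) = ⊥-elim (<ₖ-irrefl refl κ₁<κ₂)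
... | inj₂ (inj₂ (there κ₂∈R)) =
  ⊥-elim (<ₖ-asym κ₁<κ₂ (All.lookup (AllPairs.head (descending-suffix (L′ ++ l ∷ []) desc)) κ₂∈R))

++-cancel-length : ∀ {A : Set} (xs ys : List A) {X Y} → length xs ≡ length ys → xs ++ X ≡ ys ++ Y → xs ≡ ys × X ≡ Y
++-cancel-length [] [] _ eq = refl , eq
++-cancel-length (x ∷ xs) (y ∷ ys) |xs|≡|ys| eq with ∷-injective eq
... | refl , eq′ with ++-cancel-length xs ys (ℕ.suc-injective |xs|≡|ys|) eq′
...   | refl , X≡Y = refl , X≡Y

replicate-∷ʳ : ∀ {A B : Set} (L : List B) l (x : A) w → replicate (length (L ++ l ∷ [])) x ++ w ≡ replicate (length L) x ++ x ∷ w
replicate-∷ʳ [] l x w = refl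
replicate-∷ʳ (_ ∷ L) l x w = cong (x ∷_) (replicate-∷ʳ L l x w)

split-like : ∀ {A B : Set} (xs : List A) (α : List B) {a b w} → length xs ≡ length (α ++ a ∷ b ∷ w) →
             Σ[ as ∈ List A ] Σ[ x ∈ A ] Σ[ y ∈ A ] Σ[ bs ∈ List A ] xs ≡ as ++ x ∷ y ∷ bs × length as ≡ length α
split-like (x ∷ y ∷ bs) [] _ = [] , x , y , bs , refl , refl
split-like (x ∷ xs) (_ ∷ α) |xs|≡ with split-like xs α (ℕ.suc-injective |xs|≡)
... | as , x′ , y , bs , refl , |as|≡ = x ∷ as , x′ , y , bs , refl , cong suc |as|≡

module _ (Sig : Signature) where

  open ≡-Reasoning

  -- The key machine on preorder words

  Letter : Set
  Letter = Maybe (Sym Sig)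

  mutual
    word : Term Sig → List Letter → List Letter
    word leaf r = nothing ∷ r
    word (node s ts) r = just s ∷ wordCh ts r

    wordCh : ∀ {k} → Vec (Term Sig) k → List Letter → List Letter
    wordCh [] r = r
    wordCh (t ∷ ts) r = word t (wordCh ts r)

  Label : Set
  Label = Sym Sig × Key

  childKeys : ℕ → ℕ → ℕ → ℕ → List Key
  childKeys p j a zero = []
  childKeys p j a (suc k) = (p , a ∸ j) ∷ childKeys p (suc j) a k

  pushChildren : ℕ → Sym Sig → List Key
  pushChildren n s = childKeys n 1 (arity Sig s) (arity Sig s)

  -- Reading the preorder word with a stack of the keys of the pending child
  -- slots (first slot on top): a letter pops a slot, and an internal node
  -- numbered n emits its decoration with the popped key and pushes its own slots.
  run : List Letter → List Key → ℕ → List Label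
  run [] st n = []
  run (_ ∷ w) [] n = []
  run (nothing ∷ w) (κ ∷ st) n = run w st n
  run (just s ∷ w) (κ ∷ st) n = (s , κ) ∷ run w (pushChildren n s ++ st) (suc n)

  stackAfter : List Letter → List Key → ℕ → List Key
  stackAfter [] st n = st
  stackAfter (_ ∷ w) [] n = []
  stackAfter (nothing ∷ w) (κ ∷ st) n = stackAfter w st n
  stackAfter (just s ∷ w) (κ ∷ st) n = stackAfter w (pushChildren n s ++ st) (suc n)

  counterAfter : List Letter → List Key → ℕ → ℕ
  counterAfter [] st n = n
  counterAfter (_ ∷ w) [] n = n
  counterAfter (nothing ∷ w) (κ ∷ st) n = counterAfter w st n
  counterAfter (just s ∷ w) (κ ∷ st) n = counterAfter w (pushChildren n s ++ st) (suc n)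

  run-[] : ∀ w n → run w [] n ≡ []
  run-[] [] n = refl
  run-[] (_ ∷ w) n = refl

  stackAfter-[] : ∀ w n → stackAfter w [] n ≡ []
  stackAfter-[] [] n = refl
  stackAfter-[] (_ ∷ w) n = refl

  run-++ : ∀ α w st n → run (α ++ w) st n ≡ run α st n ++ run w (stackAfter α st n) (counterAfter α st n)
  run-++ [] w st n = refl
  run-++ (_ ∷ α) w [] n = sym (run-[] w n)
  run-++ (nothing ∷ α) w (κ ∷ st) n = run-++ α w st n
  run-++ (just s ∷ α) w (κ ∷ st) n = cong ((s , κ) ∷_) (run-++ α w (pushChildren n s ++ st) (suc n))

  stackAfter-++ : ∀ α w st n → stackAfter (α ++ w) st n ≡ stackAfter w (stackAfter α st n) (counterAfter α st n)
  stackAfter-++ [] w st n = refl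
  stackAfter-++ (_ ∷ α) w [] n = sym (stackAfter-[] w n)
  stackAfter-++ (nothing ∷ α) w (κ ∷ st) n = stackAfter-++ α w st n
  stackAfter-++ (just s ∷ α) w (κ ∷ st) n = stackAfter-++ α w (pushChildren n s ++ st) (suc n)

  label : NodeInfo Sig → Label
  label (mkInfo s p j a) = s , (p , a ∸ j)

  labels : Term Sig → List Label
  labels t = map label (infos Sig t)

  keys : Term Sig → List Key
  keys t = map proj₂ (labels t)

  mutual
    run-word : ∀ p j a n t r st →
      run (word t r) ((p , a ∸ j) ∷ st) n ≡
      map label (walk Sig p j a n t) ++ run r st (n + length (walk Sig p j a n t))
    run-word p j a n leaf r st rewrite ℕ.+-identityʳ n = refl
    run-word p j a n (node s ts) r st
      rewrite run-wordCh n 1 (arity Sig s) (suc n) ts r st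
            | ℕ.+-suc n (length (walkCh Sig n 1 (arity Sig s) (suc n) ts)) = refl

    run-wordCh : ∀ p j a n {k} (ts : Vec (Term Sig) k) r st →
      run (wordCh ts r) (childKeys p j a k ++ st) n ≡
      map label (walkCh Sig p j a n ts) ++ run r st (n + length (walkCh Sig p j a n ts))
    run-wordCh p j a n [] r st rewrite ℕ.+-identityʳ n = refl
    run-wordCh p j a n {suc k} (t ∷ ts) r st = begin
      run (word t (wordCh ts r)) ((p , a ∸ j) ∷ (childKeys p (suc j) a k ++ st)) n
        ≡⟨ run-word p j a n t (wordCh ts r) (childKeys p (suc j) a k ++ st) ⟩
      map label W ++ run (wordCh ts r) (childKeys p (suc j) a k ++ st) m
        ≡⟨ cong (map label W ++_) (run-wordCh p (suc j) a m ts r st) ⟩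
      map label W ++ (map label C ++ run r st (m + length C))
        ≡⟨ sym (++-assoc (map label W) (map label C) _) ⟩
      (map label W ++ map label C) ++ run r st (m + length C)
        ≡⟨ cong₂ _++_ (sym (map-++ label W C))
                      (cong (run r st) (trans (ℕ.+-assoc n (length W) (length C)) (cong (n +_) (sym (length-++ W))))) ⟩
      map label (W ++ C) ++ run r st (n + length (W ++ C)) ∎
      where
        W = walk Sig p j a n t
        m = n + length W
        C = walkCh Sig p (suc j) a m ts

  -- The root′s parent edge is (1,0,1), so its slot key is (1 , a); for a leaf
  -- any one-element stack would do.
  initialStack : Term Sig → List Key
  initialStack leaf = (0 , 0) ∷ []
  initialStack (node s _) = (1 , arity Sig s) ∷ []

  labels-run : ∀ t → labels t ≡ run (word t []) (initialStack t) 1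
  labels-run leaf = refl
  labels-run (node s ts) = sym (trans (run-word 1 0 (arity Sig s) 1 (node s ts) [] []) (++-identityʳ _))

  Invariant : ℕ → List Key → Set
  Invariant n st = Descending st × All (λ κ → proj₁ κ < n) (drop 1 st)

  Invariant-pop : ∀ {n κ st} → Invariant n (κ ∷ st) → Invariant n st
  Invariant-pop (_ ∷ desc , below) = desc , All.drop⁺ 1 below

  childKeys-parent : ∀ p j a k → All (λ κ → proj₁ κ ≡ p) (childKeys p j a k)
  childKeys-parent p j a zero = []
  childKeys-parent p j a (suc k) = refl ∷ childKeys-parent p (suc j) a k

  childKeys-below : ∀ p j a k → j + k ≤ a → All (_<ₖ (p , a ∸ j)) (childKeys p (suc j) a k)
  childKeys-below p j a zero _ = []
  childKeys-below p j a (suc k) j+k≤a =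
    next<this ∷ All.map (λ κ<next → <ₖ-trans κ<next next<this) (childKeys-below p (suc j) a k sj+k≤a)
    where
      sj+k≤a : suc j + k ≤ a
      sj+k≤a = subst (_≤ a) (ℕ.+-suc j k) j+k≤a
      next<this : (p , a ∸ suc j) <ₖ (p , a ∸ j)
      next<this = inj₂ (refl , ℕ.∸-monoʳ-< (ℕ.n<1+n j) (ℕ.≤-trans (s≤s (ℕ.m≤m+n j k)) sj+k≤a))

  childKeys-descending : ∀ p j a k → j + k ≤ a → Descending (childKeys p (suc j) a k)
  childKeys-descending p j a zero _ = []
  childKeys-descending p j a (suc k) j+k≤a =
    childKeys-below p (suc j) a k sj+k≤a ∷ childKeys-descending p (suc j) a k sj+k≤a
    where
      sj+k≤a : suc j + k ≤ a
      sj+k≤a = subst (_≤ a) (ℕ.+-suc j k) j+k≤a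

  Invariant-push : ∀ {n κ st} s → Invariant n (κ ∷ st) → Invariant (suc n) (pushChildren n s ++ st)
  Invariant-push {n} s (_ ∷ desc , below) =
    AllPairs.++⁺ (childKeys-descending n 0 a a ℕ.≤-refl) desc
                 (All.map (λ { refl → All.map inj₁ below }) parents)
    , All.drop⁺ 1 (All.++⁺ (All.map (λ { refl → ℕ.≤-refl }) parents) (All.map ℕ.m<n⇒m<1+n below))
    where
      a = arity Sig s
      parents = childKeys-parent n 1 a a

  Invariant-stackAfter : ∀ α st n → Invariant n st → Invariant (counterAfter α st n) (stackAfter α st n)
  Invariant-stackAfter [] st n inv = inv
  Invariant-stackAfter (_ ∷ α) [] n _ = [] , []
  Invariant-stackAfter (nothing ∷ α) (κ ∷ st) n inv = Invariant-stackAfter α st n (Invariant-pop inv)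
  Invariant-stackAfter (just s ∷ α) (κ ∷ st) n inv =
    Invariant-stackAfter α (pushChildren n s ++ st) (suc n) (Invariant-push s inv)

  -- Concatenations of the preorder words of k terms (Łukasiewicz words).
  data ForestWord : ℕ → List Letter → Set where
    []  : ForestWord 0 []
    _∷ℓ : ∀ {k w} → ForestWord k w → ForestWord (suc k) (nothing ∷ w)
    _∷ₙ_ : ∀ {k w} s → ForestWord (arity Sig s + k) w → ForestWord (suc k) (just s ∷ w)

  mutual
    word-forest : ∀ {k} t r → ForestWord k r → ForestWord (suc k) (word t r)
    word-forest leaf r f = f ∷ℓ
    word-forest (node s ts) r f = s ∷ₙ wordCh-forest ts r f

    wordCh-forest : ∀ {k m} (ts : Vec (Term Sig) m) r → ForestWord k r → ForestWord (m + k) (wordCh ts r)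
    wordCh-forest [] r f = f
    wordCh-forest (t ∷ ts) r f = word-forest t (wordCh ts r) (wordCh-forest ts r f)

  length-push : ∀ n s st → length (pushChildren n s ++ st) ≡ arity Sig s + length st
  length-push n s st = trans (length-++ (pushChildren n s)) (cong (_+ length st) (length-childKeys n 1 (arity Sig s) (arity Sig s)))
    where
      length-childKeys : ∀ p j a k → length (childKeys p j a k) ≡ k
      length-childKeys p j a zero = refl
      length-childKeys p j a (suc k) = cong suc (length-childKeys p (suc j) a k)

  ForestWord-stackAfter : ∀ α w st n → ForestWord (length st) (α ++ w) → ForestWord (length (stackAfter α st n)) w
  ForestWord-stackAfter [] w st n f = f
  ForestWord-stackAfter (nothing ∷ α) w (κ ∷ st) n (f ∷ℓ) = ForestWord-stackAfter α w st n f
  ForestWord-stackAfter (just s ∷ α) w (κ ∷ st) n (.s ∷ₙ f) =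
    ForestWord-stackAfter α w (pushChildren n s ++ st) (suc n) (subst (λ k → ForestWord k (α ++ w)) (sym (length-push n s st)) f)

  -- Inverse of run on forest words: a slot whose key is not the next
  -- emitted key was filled by a leaf.
  mutual
    decode : ℕ → List Label → List Key → List Letter
    decode n [] st = replicate (length st) nothing
    decode n (x ∷ I) st = decodeNext n x I st

    decodeNext : ℕ → Label → List Label → List Key → List Letter
    decodeNext n x I [] = []
    decodeNext n (s , κ′) I (κ ∷ st) with κ ≟ₖ κ′
    ... | yes _ = just s ∷ decode (suc n) I (pushChildren n s ++ st)
    ... | no _ = nothing ∷ decodeNext n (s , κ′) I st

  run-head-∈ : ∀ w st n {x I} → run w st n ≡ x ∷ I → proj₂ x ∈ st
  run-head-∈ w [] n eq rewrite run-[] w n = case eq of λ ()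
  run-head-∈ (nothing ∷ w) (κ ∷ st) n eq = there (run-head-∈ w st n eq)
  run-head-∈ (just s ∷ w) (κ ∷ st) n refl = here refl

  decode-node : ∀ n s κ I st → decode n ((s , κ) ∷ I) (κ ∷ st) ≡ just s ∷ decode (suc n) I (pushChildren n s ++ st)
  decode-node n s κ I st with κ ≟ₖ κ
  ... | yes _ = refl
  ... | no κ≢κ = ⊥-elim (κ≢κ refl)

  decode-leaf : ∀ w κ st n → All (_<ₖ κ) st → decode n (run w st n) (κ ∷ st) ≡ nothing ∷ decode n (run w st n) st
  decode-leaf w κ st n below with run w st n in eq
  ... | [] = refl
  ... | (s , κ′) ∷ I with κ ≟ₖ κ′
  ...   | yes refl = ⊥-elim (<ₖ-irrefl refl (All.lookup below (run-head-∈ w st n eq)))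
  ...   | no _ = refl

  decode-run : ∀ w st n → Invariant n st → ForestWord (length st) w → decode n (run w st n) st ≡ w
  decode-run [] [] n _ [] = refl
  decode-run (nothing ∷ w) (κ ∷ st) n inv (f ∷ℓ) =
    trans (decode-leaf w κ st n (AllPairs.head (proj₁ inv))) (cong (nothing ∷_) (decode-run w st n (Invariant-pop inv) f))
  decode-run (just s ∷ w) (κ ∷ st) n inv (.s ∷ₙ f) =
    trans (decode-node n s κ _ st)
      (cong (just s ∷_) (decode-run w (pushChildren n s ++ st) (suc n) (Invariant-push s inv)
        (subst (λ k → ForestWord k w) (sym (length-push n s st)) f)))

  mutual
    word-injective : ∀ t t′ r r′ → word t r ≡ word t′ r′ → t ≡ t′ × r ≡ r′
    word-injective leaf leaf r r′ refl = refl , refl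
    word-injective (node s ts) (node s′ ts′) r r′ eq with ∷-injective eq
    ... | refl , eq′ with wordCh-injective ts ts′ r r′ eq′
    ...   | refl , refl = refl , refl

    wordCh-injective : ∀ {m} (ts ts′ : Vec (Term Sig) m) r r′ → wordCh ts r ≡ wordCh ts′ r′ → ts ≡ ts′ × r ≡ r′
    wordCh-injective [] [] r r′ eq = refl , eq
    wordCh-injective (t ∷ ts) (t′ ∷ ts′) r r′ eq with word-injective t t′ _ _ eq
    ... | refl , eq′ with wordCh-injective ts ts′ r r′ eq′
    ...   | refl , refl = refl , refl

  dc-labels : ∀ t → dc Sig t ≡ map proj₁ (labels t)
  dc-labels t = map-∘ (infos Sig t)

  cnc-keys : ∀ t → cnc Sig t ≡ map keyValue (keys t)
  cnc-keys t = trans (map-∘ (infos Sig t)) (cong (map keyValue) (map-∘ (infos Sig t)))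

  initialStack-dc : ∀ t t′ → dc Sig t ≡ dc Sig t′ → initialStack t ≡ initialStack t′
  initialStack-dc leaf leaf _ = refl
  initialStack-dc (node s ts) (node s′ ts′) eq with ∷-injective eq
  ... | refl , _ = refl

  Invariant-initial : ∀ t → Invariant 1 (initialStack t)
  Invariant-initial leaf = [] ∷ [] , []
  Invariant-initial (node s ts) = [] ∷ [] , []

  ForestWord-initial : ∀ t → ForestWord (length (initialStack t)) (word t [])
  ForestWord-initial leaf = word-forest leaf [] []
  ForestWord-initial (node s ts) = word-forest (node s ts) [] []

  labels-injective : ∀ t t′ → labels t ≡ labels t′ → t ≡ t′
  labels-injective t t′ eq = proj₁ (word-injective t t′ [] [] (begin
    word t []                                        ≡⟨ sym (decode-run _ _ 1 (Invariant-initial t) (ForestWord-initial t)) ⟩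
    decode 1 (run (word t []) (initialStack t) 1) (initialStack t)
      ≡⟨ cong₂ (decode 1) (trans (sym (labels-run t)) (trans eq (labels-run t′))) same-initial ⟩
    decode 1 (run (word t′ []) (initialStack t′) 1) (initialStack t′)
      ≡⟨ decode-run _ _ 1 (Invariant-initial t′) (ForestWord-initial t′) ⟩
    word t′ [] ∎))
    where
      same-initial : initialStack t ≡ initialStack t′
      same-initial = initialStack-dc t t′ (trans (dc-labels t) (trans (cong (map proj₁) eq) (sym (dc-labels t′))))

  popThrough : Key → List Key → List Key
  popThrough κ [] = []
  popThrough κ (κ′ ∷ st) with κ ≟ₖ κ′
  ... | yes _ = st
  ... | no _ = popThrough κ st

  popThrough-top : ∀ κ st → popThrough κ (κ ∷ st) ≡ st
  popThrough-top κ st with κ ≟ₖ κ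
  ... | yes _ = refl
  ... | no κ≢κ = ⊥-elim (κ≢κ refl)

  popThrough-above : ∀ {κ κ′} st → κ <ₖ κ′ → popThrough κ (κ′ ∷ st) ≡ popThrough κ st
  popThrough-above {κ} {κ′} st κ<κ′ with κ ≟ₖ κ′
  ... | yes refl = ⊥-elim (<ₖ-irrefl refl κ<κ′)
  ... | no _ = refl

  -- The stack recovered from the emitted labels alone: every slot above the
  -- next emitted key must have been a leaf.
  replay : List Key → ℕ → List Label → List Key
  replay st n [] = st
  replay st n ((s , κ) ∷ I) = replay (pushChildren n s ++ popThrough κ st) (suc n) I

  replay-pop : ∀ w κ st n → All (_<ₖ κ) st →
               ∃ λ M → replay (κ ∷ st) n (run w st n) ≡ M ++ replay st n (run w st n)
  replay-pop w κ st n below with run w st n in eq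
  ... | [] = κ ∷ [] , refl
  ... | (s , κ′) ∷ I =
    [] , cong (λ st′ → replay (pushChildren n s ++ st′) (suc n) I)
              (popThrough-above st (All.lookup below (run-head-∈ w st n eq)))

  -- The leaves read since the last internal node remain on the replayed stack.
  replay-run : ∀ α st n → Invariant n st → ∃ λ M → replay st n (run α st n) ≡ M ++ stackAfter α st n
  replay-run [] st n _ = [] , refl
  replay-run (_ ∷ α) [] n _ = [] , refl
  replay-run (nothing ∷ α) (κ ∷ st) n inv with replay-pop α κ st n (AllPairs.head (proj₁ inv))
                                             | replay-run α st n (Invariant-pop inv)
  ... | M₀ , eq₀ | M , eq = M₀ ++ M , trans eq₀ (trans (cong (M₀ ++_) eq) (sym (++-assoc M₀ M _)))
  replay-run (just s ∷ α) (κ ∷ st) n inv with replay-run α (pushChildren n s ++ st) (suc n) (Invariant-push s inv)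
  ... | M , eq = M , trans (cong (λ st′ → replay (pushChildren n s ++ st′) (suc n) (run α (pushChildren n s ++ st) (suc n)))
                                 (popThrough-top κ st)) eq

  -- Reading w up to the node that emits (s , κ) right after I: the slots above
  -- κ on the replayed stack are filled by leaves.
  record Located (w : List Letter) (st : List Key) (n : ℕ) (I : List Label) (s : Sym Sig) (κ : Key) : Set where
    field
      prefix : List Letter
      above : List Key
      below : List Key
      rest : List Letter
      word-split : w ≡ prefix ++ replicate (length above) nothing ++ just s ∷ rest
      run-prefix : run prefix st n ≡ I
      stackAfter-prefix : stackAfter prefix st n ≡ replay st n I
      replay-split : replay st n I ≡ above ++ κ ∷ below

  locate-first : ∀ w st n {s κ J} → run w st n ≡ (s , κ) ∷ J →
                 Σ[ L ∈ List Key ] Σ[ R ∈ List Key ] Σ[ w′ ∈ List Letter ]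
                   w ≡ replicate (length L) nothing ++ just s ∷ w′ × st ≡ L ++ κ ∷ R
  locate-first w [] n eq rewrite run-[] w n = case eq of λ ()
  locate-first (nothing ∷ w) (κ′ ∷ st) n eq with locate-first w st n eq
  ... | L , R , w′ , refl , refl = κ′ ∷ L , R , w′ , refl , refl
  locate-first (just s ∷ w) (κ ∷ st) n refl = [] , st , w , refl , refl

  locate : ∀ w st n I {s κ J} → Invariant n st → run w st n ≡ I ++ (s , κ) ∷ J → Located w st n I s κ
  locate w st n [] _ eq with locate-first w st n eq
  ... | L , R , w′ , w≡ , st≡ = record
    { prefix = [] ; above = L ; below = R ; rest = w′ ; word-split = w≡
    ; run-prefix = refl ; stackAfter-prefix = refl ; replay-split = st≡ }
  locate w [] n (x ∷ I) _ eq rewrite run-[] w n = case eq of λ ()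
  locate (nothing ∷ w) (κ′ ∷ st) n (x ∷ I) inv eq =
    record { prefix = nothing ∷ prefix ; above = above ; below = below ; rest = rest
           ; word-split = cong (nothing ∷_) word-split ; run-prefix = run-prefix
           ; stackAfter-prefix = trans stackAfter-prefix (sym replay-leaf)
           ; replay-split = trans replay-leaf replay-split }
    where
      loc = locate w st n (x ∷ I) (Invariant-pop inv) eq
      open Located loc
      replay-leaf : replay (κ′ ∷ st) n (x ∷ I) ≡ replay st n (x ∷ I)
      replay-leaf = cong (λ st′ → replay (pushChildren n (proj₁ x) ++ st′) (suc n) I)
                         (popThrough-above st (All.lookup (AllPairs.head (proj₁ inv)) (run-head-∈ w st n eq)))
  locate (just s′ ∷ w) (κ′ ∷ st) n (x ∷ I) inv eq with ∷-injective eq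
  ... | refl , eq′ =
    record { prefix = just s′ ∷ prefix ; above = above ; below = below ; rest = rest
           ; word-split = cong (just s′ ∷_) word-split
           ; run-prefix = cong ((s′ , κ′) ∷_) run-prefix
           ; stackAfter-prefix = trans stackAfter-prefix (sym replay-node)
           ; replay-split = trans replay-node replay-split }
    where
      loc = locate w (pushChildren n s′ ++ st) (suc n) I (Invariant-push s′ inv) eq′
      open Located loc
      replay-node : replay (κ′ ∷ st) n ((s′ , κ′) ∷ I) ≡ replay (pushChildren n s′ ++ st) (suc n) I
      replay-node = cong (λ st′ → replay (pushChildren n s′ ++ st′) (suc n) I) (popThrough-top κ′ st)

  emitted-key-replayed : ∀ w st n I {s κ J} → Invariant n st → run w st n ≡ I ++ (s , κ) ∷ J →
                         Descending (replay st n I) × κ ∈ replay st n I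
  emitted-key-replayed w st n I inv eq =
    subst Descending stackAfter-prefix (proj₁ (Invariant-stackAfter prefix st n inv))
    , subst (_ ∈_) (sym replay-split) (∈-++⁺ʳ above (here refl))
    where open Located (locate w st n I inv eq)

  run-leaves : ∀ m st n → run (replicate m nothing) st n ≡ []
  run-leaves zero st n = refl
  run-leaves (suc m) [] n = refl
  run-leaves (suc m) (_ ∷ st) n = run-leaves m st n

  stackAfter-leaves : ∀ L Z n → stackAfter (replicate (length L) nothing) (L ++ Z) n ≡ Z
  stackAfter-leaves [] Z n = refl
  stackAfter-leaves (_ ∷ L) Z n = stackAfter-leaves L Z n

  skip-leaves : ∀ {w st n I s κ} (loc : Located w st n I s κ) L′ l → Located.above loc ≡ L′ ++ l ∷ [] →
    Σ[ α ∈ List Letter ] Σ[ w′ ∈ List Letter ]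
      w ≡ α ++ nothing ∷ just s ∷ w′ × run α st n ≡ I × stackAfter α st n ≡ l ∷ κ ∷ Located.below loc
  skip-leaves {w} {st} {n} {I} {s} {κ} loc L′ l refl =
    prefix ++ leaves , rest , word≡ , run≡ , stack≡
    where
      open Located loc
      leaves = replicate (length L′) nothing
      word≡ : w ≡ (prefix ++ leaves) ++ nothing ∷ just s ∷ rest
      word≡ = trans word-split (trans (cong (prefix ++_) (replicate-∷ʳ L′ l nothing _)) (sym (++-assoc prefix leaves _)))
      run≡ : run (prefix ++ leaves) st n ≡ I
      run≡ = begin
        run (prefix ++ leaves) st n
          ≡⟨ run-++ prefix leaves st n ⟩
        run prefix st n ++ run leaves (stackAfter prefix st n) (counterAfter prefix st n)
          ≡⟨ cong₂ _++_ run-prefix (run-leaves (length L′) (stackAfter prefix st n) (counterAfter prefix st n)) ⟩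
        I ++ []
          ≡⟨ ++-identityʳ I ⟩
        I ∎
      stack≡ : stackAfter (prefix ++ leaves) st n ≡ l ∷ κ ∷ below
      stack≡ = begin
        stackAfter (prefix ++ leaves) st n
          ≡⟨ stackAfter-++ prefix leaves st n ⟩
        stackAfter leaves (stackAfter prefix st n) (counterAfter prefix st n)
          ≡⟨ cong (λ st′ → stackAfter leaves st′ (counterAfter prefix st n))
                  (trans stackAfter-prefix (trans replay-split (++-assoc L′ (l ∷ []) _))) ⟩
        stackAfter leaves (L′ ++ l ∷ κ ∷ below) (counterAfter prefix st n)
          ≡⟨ stackAfter-leaves L′ _ _ ⟩
        l ∷ κ ∷ below ∎

  mutual
    word-++ : ∀ t r → word t r ≡ word t [] ++ r
    word-++ leaf r = refl
    word-++ (node s ts) r = cong (just s ∷_) (wordCh-++ ts r)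

    wordCh-++ : ∀ {m} (ts : Vec (Term Sig) m) r → wordCh ts r ≡ wordCh ts [] ++ r
    wordCh-++ [] r = refl
    wordCh-++ (t ∷ ts) r = begin
      word t (wordCh ts r)                ≡⟨ word-++ t (wordCh ts r) ⟩
      word t [] ++ wordCh ts r            ≡⟨ cong (word t [] ++_) (wordCh-++ ts r) ⟩
      word t [] ++ (wordCh ts [] ++ r)    ≡⟨ sym (++-assoc (word t []) (wordCh ts []) r) ⟩
      (word t [] ++ wordCh ts []) ++ r    ≡⟨ cong (_++ r) (sym (word-++ t (wordCh ts []))) ⟩
      word t (wordCh ts []) ++ r          ∎

  mutual
    length-word : ∀ t → length (word t []) ≡ length (positions Sig t)
    length-word leaf = refl
    length-word (node s ts) = cong suc (length-wordCh ts 0)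

    length-wordCh : ∀ {m} (ts : Vec (Term Sig) m) c → length (wordCh ts []) ≡ length (positionsCh Sig c ts)
    length-wordCh [] c = refl
    length-wordCh (t ∷ ts) c = begin
      length (word t (wordCh ts []))                            ≡⟨ cong length (word-++ t (wordCh ts [])) ⟩
      length (word t [] ++ wordCh ts [])                        ≡⟨ length-++ (word t []) ⟩
      length (word t []) + length (wordCh ts [])                ≡⟨ cong₂ _+_ (trans (length-word t) (sym (length-map (c ∷_) (positions Sig t))))
                                                                             (length-wordCh ts (suc c)) ⟩
      length (map (c ∷_) (positions Sig t)) + length (positionsCh Sig (suc c) ts)
                                                                ≡⟨ sym (length-++ (map (c ∷_) (positions Sig t))) ⟩
      length (positionsCh Sig c (t ∷ ts))                       ∎

  nth-++⁻ : ∀ {A : Set} (xs ys : List A) k {x} → nth Sig (xs ++ ys) k ≡ just x →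
            nth Sig xs k ≡ just x ⊎ ∃ λ k′ → k ≡ length xs + k′ × nth Sig ys k′ ≡ just x
  nth-++⁻ [] ys k eq = inj₂ (k , refl , eq)
  nth-++⁻ (_ ∷ xs) ys zero eq = inj₁ eq
  nth-++⁻ (_ ∷ xs) ys (suc k) eq with nth-++⁻ xs ys k eq
  ... | inj₁ eq′ = inj₁ eq′
  ... | inj₂ (k′ , refl , eq′) = inj₂ (k′ , refl , eq′)

  nth-map⁻ : ∀ {A B : Set} (f : A → B) xs k {y} → nth Sig (map f xs) k ≡ just y → ∃ λ x → nth Sig xs k ≡ just x × f x ≡ y
  nth-map⁻ f (x ∷ xs) zero refl = x , refl , refl
  nth-map⁻ f (x ∷ xs) (suc k) eq = nth-map⁻ f xs k eq

  nth-length : ∀ {A : Set} (xs ys : List A) → nth Sig (xs ++ ys) (length xs) ≡ nth Sig ys 0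
  nth-length [] ys = refl
  nth-length (x ∷ xs) ys = nth-length xs ys

  mutual
    replace-subterm : ∀ t p {u} → subterm Sig t p ≡ just u → replace Sig t p u ≡ t
    replace-subterm t [] refl = refl
    replace-subterm (node s ts) (c ∷ p) eq = cong (node s) (replaceCh-subtermCh ts c p eq)

    replaceCh-subtermCh : ∀ {m} (ts : Vec (Term Sig) m) c p {u} → subtermCh Sig ts c p ≡ just u → replaceCh Sig ts c p u ≡ ts
    replaceCh-subtermCh (t ∷ ts) zero p eq = cong (_∷ ts) (replace-subterm t p eq)
    replaceCh-subtermCh (t ∷ ts) (suc c) p eq = cong (t ∷_) (replaceCh-subtermCh ts c p eq)

  -- A one-hole context, described by the word and positions of its fillings,
  -- whose hole is the k-th node in preorder and sits at position p.
  record HoleAt (fill-word : Term Sig → List Letter → List Letter) (fill-positions : Term Sig → List (Path Sig))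
                (p : Path Sig) (k : ℕ) : Set where
    field
      left : List Letter
      right : List Letter → List Letter
      before : List (Path Sig)
      after : List (Path Sig)
      length-left : length left ≡ k
      length-before : length before ≡ k
      word-fill : ∀ v r → fill-word v r ≡ left ++ word v (right r)
      positions-fill : ∀ v → fill-positions v ≡ before ++ map (p ++_) (positions Sig v) ++ after

  HoleOf : Term Sig → Path Sig → ℕ → Set
  HoleOf t p = HoleAt (λ v → word (replace Sig t p v)) (λ v → positions Sig (replace Sig t p v)) p

  HoleOfCh : ∀ {m} → Vec (Term Sig) m → ℕ → ℕ → Path Sig → Path Sig → ℕ → Set
  HoleOfCh ts c i q = HoleAt (λ v → wordCh (replaceCh Sig ts i q v)) (λ v → positionsCh Sig c (replaceCh Sig ts i q v))

  private
    positions-shift : ∀ {m} c q (ts : Vec (Term Sig) m) X {Y} (before after : List (Path Sig)) → Y ≡ before ++ map (q ++_) X ++ after →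
      map (c ∷_) Y ++ positionsCh Sig (suc c) ts
        ≡ map (c ∷_) before ++ map ((c ∷ q) ++_) X ++ (map (c ∷_) after ++ positionsCh Sig (suc c) ts)
    positions-shift c q ts X before after refl = begin
      map (c ∷_) (before ++ map (q ++_) X ++ after) ++ rest
        ≡⟨ cong (_++ rest) (map-++ (c ∷_) before _) ⟩
      (map (c ∷_) before ++ map (c ∷_) (map (q ++_) X ++ after)) ++ rest
        ≡⟨ cong (λ z → (map (c ∷_) before ++ z) ++ rest) (map-++ (c ∷_) (map (q ++_) X) after) ⟩
      (map (c ∷_) before ++ (map (c ∷_) (map (q ++_) X) ++ map (c ∷_) after)) ++ rest
        ≡⟨ cong (λ z → (map (c ∷_) before ++ (z ++ map (c ∷_) after)) ++ rest) (sym (map-∘ X)) ⟩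
      (map (c ∷_) before ++ (map ((c ∷ q) ++_) X ++ map (c ∷_) after)) ++ rest
        ≡⟨ ++-assoc (map (c ∷_) before) _ rest ⟩
      map (c ∷_) before ++ ((map ((c ∷ q) ++_) X ++ map (c ∷_) after) ++ rest)
        ≡⟨ cong (map (c ∷_) before ++_) (++-assoc (map ((c ∷ q) ++_) X) _ rest) ⟩
      map (c ∷_) before ++ map ((c ∷ q) ++_) X ++ (map (c ∷_) after ++ rest) ∎
      where rest = positionsCh Sig (suc c) ts

  root-hole : HoleAt word (positions Sig) [] 0
  root-hole = record
    { left = [] ; right = λ r → r ; before = [] ; after = [] ; length-left = refl ; length-before = refl
    ; word-fill = λ v r → refl
    ; positions-fill = λ v → sym (trans (++-identityʳ _) (map-id (positions Sig v))) }

  mutual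
    focus : ∀ t k p → nth Sig (positions Sig t) k ≡ just p → Σ[ u ∈ Term Sig ] subterm Sig t p ≡ just u × HoleOf t p k
    focus leaf zero p refl = leaf , refl , root-hole
    focus (node s ts) zero p refl = node s ts , refl , root-hole
    focus (node s ts) (suc k) p eq with focusCh ts 0 k p eq
    ... | i , q , refl , u , u≡ , hole = u , u≡ , record
      { left = just s ∷ left ; right = right ; before = [] ∷ before ; after = after
      ; length-left = cong suc length-left ; length-before = cong suc length-before
      ; word-fill = λ v r → cong (just s ∷_) (word-fill v r)
      ; positions-fill = λ v → cong ([] ∷_) (positions-fill v) }
      where open HoleAt hole

    focusCh : ∀ {m} (ts : Vec (Term Sig) m) c k p → nth Sig (positionsCh Sig c ts) k ≡ just p →
              Σ[ i ∈ ℕ ] Σ[ q ∈ Path Sig ] p ≡ (c + i) ∷ q ×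
                Σ[ u ∈ Term Sig ] subtermCh Sig ts i q ≡ just u × HoleOfCh ts c i q p k
    focusCh (t ∷ ts) c k p eq with nth-++⁻ (map (c ∷_) (positions Sig t)) (positionsCh Sig (suc c) ts) k eq
    ... | inj₁ eq₁ with nth-map⁻ (c ∷_) (positions Sig t) k eq₁
    ...   | q , eq₂ , refl with focus t k q eq₂
    ...     | u , u≡ , hole =
      0 , q , cong (_∷ q) (sym (ℕ.+-identityʳ c)) , u , u≡ , record
      { left = left ; right = λ r → right (wordCh ts r)
      ; before = map (c ∷_) before ; after = map (c ∷_) after ++ positionsCh Sig (suc c) ts
      ; length-left = length-left ; length-before = trans (length-map (c ∷_) before) length-before
      ; word-fill = λ v r → word-fill v (wordCh ts r)
      ; positions-fill = λ v → positions-shift c q ts (positions Sig v) before after (positions-fill v) }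
      where open HoleAt hole
    focusCh (t ∷ ts) c k p eq | inj₂ (k′ , refl , eq₁) with focusCh ts (suc c) k′ p eq₁
    ... | i , q , refl , u , u≡ , hole =
      suc i , q , cong (_∷ q) (sym (ℕ.+-suc c i)) , u , u≡ , record
      { left = word t [] ++ left ; right = right
      ; before = map (c ∷_) (positions Sig t) ++ before ; after = after
      ; length-left = trans (length-++ (word t []))
          (cong₂ _+_ (trans (length-word t) (sym (length-map (c ∷_) (positions Sig t)))) length-left)
      ; length-before = trans (length-++ (map (c ∷_) (positions Sig t))) (cong (length (map (c ∷_) (positions Sig t)) +_) length-before)
      ; word-fill = λ v r → trans (word-++ t _) (trans (cong (word t [] ++_) (word-fill v r)) (sym (++-assoc (word t []) left _)))
      ; positions-fill = λ v → trans (cong (map (c ∷_) (positions Sig t) ++_) (positions-fill v))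
                                     (sym (++-assoc (map (c ∷_) (positions Sig t)) before _)) }
      where open HoleAt hole

  selectInternal : List Letter → List (Path Sig) → List (Path Sig)
  selectInternal (just _ ∷ w) (p ∷ ps) = p ∷ selectInternal w ps
  selectInternal (nothing ∷ w) (_ ∷ ps) = selectInternal w ps
  selectInternal _ _ = []

  mutual
    selectInternal-word : ∀ t (f : Path Sig → Path Sig) w ps →
      selectInternal (word t w) (map f (positions Sig t) ++ ps) ≡ map f (internalPositions Sig t) ++ selectInternal w ps
    selectInternal-word leaf f w ps = refl
    selectInternal-word (node s ts) f w ps = cong (f [] ∷_) (selectInternal-wordCh ts 0 f w ps)

    selectInternal-wordCh : ∀ {m} (ts : Vec (Term Sig) m) c (f : Path Sig → Path Sig) w ps →
      selectInternal (wordCh ts w) (map f (positionsCh Sig c ts) ++ ps) ≡ map f (internalPositionsCh Sig c ts) ++ selectInternal w ps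
    selectInternal-wordCh [] c f w ps = refl
    selectInternal-wordCh (t ∷ ts) c f w ps = begin
      selectInternal (word t (wordCh ts w)) (map f (map (c ∷_) (positions Sig t) ++ positionsCh Sig (suc c) ts) ++ ps)
        ≡⟨ cong (λ z → selectInternal (word t (wordCh ts w)) (z ++ ps)) (map-++ f (map (c ∷_) (positions Sig t)) _) ⟩
      selectInternal (word t (wordCh ts w)) ((map f (map (c ∷_) (positions Sig t)) ++ map f (positionsCh Sig (suc c) ts)) ++ ps)
        ≡⟨ cong (selectInternal (word t (wordCh ts w))) (++-assoc (map f (map (c ∷_) (positions Sig t))) _ ps) ⟩
      selectInternal (word t (wordCh ts w)) (map f (map (c ∷_) (positions Sig t)) ++ (map f (positionsCh Sig (suc c) ts) ++ ps))
        ≡⟨ cong (λ z → selectInternal (word t (wordCh ts w)) (z ++ _)) (sym (map-∘ (positions Sig t))) ⟩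
      selectInternal (word t (wordCh ts w)) (map (f ∘ (c ∷_)) (positions Sig t) ++ (map f (positionsCh Sig (suc c) ts) ++ ps))
        ≡⟨ selectInternal-word t (f ∘ (c ∷_)) (wordCh ts w) _ ⟩
      map (f ∘ (c ∷_)) (internalPositions Sig t) ++ selectInternal (wordCh ts w) (map f (positionsCh Sig (suc c) ts) ++ ps)
        ≡⟨ cong₂ _++_ (map-∘ (internalPositions Sig t)) (selectInternal-wordCh ts (suc c) f w ps) ⟩
      map f (map (c ∷_) (internalPositions Sig t)) ++ (map f (internalPositionsCh Sig (suc c) ts) ++ selectInternal w ps)
        ≡⟨ sym (++-assoc (map f (map (c ∷_) (internalPositions Sig t))) _ _) ⟩
      (map f (map (c ∷_) (internalPositions Sig t)) ++ map f (internalPositionsCh Sig (suc c) ts)) ++ selectInternal w ps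
        ≡⟨ cong (_++ selectInternal w ps) (sym (map-++ f (map (c ∷_) (internalPositions Sig t)) _)) ⟩
      map f (internalPositionsCh Sig c (t ∷ ts)) ++ selectInternal w ps ∎

  internalPositions-selectInternal : ∀ t → internalPositions Sig t ≡ selectInternal (word t []) (positions Sig t)
  internalPositions-selectInternal t = begin
    internalPositions Sig t                                ≡⟨ sym (trans (++-identityʳ _) (map-id _)) ⟩
    map id (internalPositions Sig t) ++ []                 ≡⟨ sym (selectInternal-word t id [] []) ⟩
    selectInternal (word t []) (map id (positions Sig t) ++ [])    ≡⟨ cong (selectInternal (word t [])) (trans (++-identityʳ _) (map-id _)) ⟩
    selectInternal (word t []) (positions Sig t)                   ∎

  nth-selectInternal⁻ : ∀ w ps k {p} → length w ≡ length ps → nth Sig (selectInternal w ps) k ≡ just p →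
                ∃ λ k′ → nth Sig ps k′ ≡ just p × ∃ λ s → nth Sig w k′ ≡ just (just s)
  nth-selectInternal⁻ (just s ∷ w) (q ∷ ps) zero _ refl = 0 , refl , s , refl
  nth-selectInternal⁻ (just s ∷ w) (q ∷ ps) (suc k) |w|≡|ps| eq with nth-selectInternal⁻ w ps k (ℕ.suc-injective |w|≡|ps|) eq
  ... | k′ , found = suc k′ , found
  nth-selectInternal⁻ (nothing ∷ w) (q ∷ ps) k |w|≡|ps| eq with nth-selectInternal⁻ w ps k (ℕ.suc-injective |w|≡|ps|) eq
  ... | k′ , found = suc k′ , found

  internalCount : List Letter → ℕ
  internalCount [] = 0
  internalCount (just _ ∷ w) = suc (internalCount w)
  internalCount (nothing ∷ w) = internalCount w

  nth-selectInternal-internalCount : ∀ α P w ps s p → length α ≡ length P →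
                             nth Sig (selectInternal (α ++ just s ∷ w) (P ++ p ∷ ps)) (internalCount α) ≡ just p
  nth-selectInternal-internalCount [] [] w ps s p _ = refl
  nth-selectInternal-internalCount (just _ ∷ α) (_ ∷ P) w ps s p |α|≡|P| =
    nth-selectInternal-internalCount α P w ps s p (ℕ.suc-injective |α|≡|P|)
  nth-selectInternal-internalCount (nothing ∷ α) (_ ∷ P) w ps s p |α|≡|P| =
    nth-selectInternal-internalCount α P w ps s p (ℕ.suc-injective |α|≡|P|)

  record Occurrence (t : Term Sig) (as : List (Path Sig)) (p : Path Sig) (u : Term Sig) : Set where
    field
      left : List Letter
      right : List Letter
      after : List (Path Sig)
      length-left : length left ≡ length as
      word-replace : ∀ v → word (replace Sig t p v) [] ≡ left ++ word v right
      positions-replace : ∀ v → positions Sig (replace Sig t p v) ≡ as ++ map (p ++_) (positions Sig v) ++ after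

    word-occurrence : subterm Sig t p ≡ just u → word t [] ≡ left ++ word u right
    word-occurrence u≡ = trans (cong (λ t′ → word t′ []) (sym (replace-subterm t p u≡))) (word-replace u)

  occurrence : ∀ t {as p ps} → positions Sig t ≡ as ++ p ∷ ps → Σ[ u ∈ Term Sig ] subterm Sig t p ≡ just u × Occurrence t as p u
  occurrence t {as} {p} {ps} pos≡ with focus t (length as) p (trans (cong (λ qs → nth Sig qs (length as)) pos≡) (nth-length as _))
  ... | u , u≡ , hole = u , u≡ , record
    { left = left ; right = right [] ; after = after
    ; length-left = length-left
    ; word-replace = λ v → word-fill v []
    ; positions-replace = λ v → trans (positions-fill v) (cong (_++ _) before≡as) }
    where
      open HoleAt hole
      before≡as : before ≡ as
      before≡as = proj₁ (++-cancel-length before as length-before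
        (trans (sym (trans (cong (positions Sig) (sym (replace-subterm t p u≡))) (positions-fill u))) pos≡))

  occurrence-of : ∀ t {as p ps u} → positions Sig t ≡ as ++ p ∷ ps → subterm Sig t p ≡ just u → Occurrence t as p u
  occurrence-of t pos≡ u≡ with occurrence t pos≡
  ... | _ , u≡′ , occ rewrite just-injective (trans (sym u≡′) u≡) = occ

  subterm-word : ∀ t {as p ps α w} → positions Sig t ≡ as ++ p ∷ ps → word t [] ≡ α ++ w → length α ≡ length as →
                 Σ[ u ∈ Term Sig ] subterm Sig t p ≡ just u × Σ[ r ∈ List Letter ] word u r ≡ w
  subterm-word t {α = α} pos≡ word≡ |α|≡|as| with occurrence t pos≡
  ... | u , u≡ , occ = u , u≡ , right , proj₂ (++-cancel-length left α (trans length-left (sym |α|≡|as|))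
                                                 (trans (sym (word-occurrence u≡)) word≡))
    where open Occurrence occ

  word-node⁻ : ∀ u r {s w} → word u r ≡ just s ∷ w → Σ[ cs ∈ Vec (Term Sig) (arity Sig s) ] u ≡ node s cs
  word-node⁻ (node s cs) r refl = cs , refl

  word-leaf⁻ : ∀ u r {w} → word u r ≡ nothing ∷ w → u ≡ leaf × r ≡ w
  word-leaf⁻ leaf r refl = refl , refl

  -- Moves as rotations of preorder words

  -- At the level of words, the move detaches the leaf read just before the
  -- node s and puts it right after the subterm rooted there.
  record Rotation (t₁ t₂ : Term Sig) (α : List Letter) (s : Sym Sig) : Set where
    field
      children : Vec (Term Sig) (arity Sig s)
      rest : List Letter
      word-source : word t₁ [] ≡ α ++ nothing ∷ just s ∷ wordCh children rest
      word-target : word t₂ [] ≡ α ++ just s ∷ wordCh children (nothing ∷ rest)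

  rotation-at : ∀ t₁ {pₓ pᵢ as bs s} {cs : Vec (Term Sig) (arity Sig s)} →
    positions Sig t₁ ≡ as ++ pₓ ∷ pᵢ ∷ bs → subterm Sig t₁ pₓ ≡ just leaf → subterm Sig t₁ pᵢ ≡ just (node s cs) →
    Σ[ α ∈ List Letter ] length α ≡ length as × Rotation t₁ (replace Sig (replace Sig t₁ pᵢ leaf) pₓ (node s cs)) α s
  rotation-at t₁ {pₓ} {pᵢ} {as} {bs} {s} {cs} pos≡ x≡ i≡ =
    X.left , X.length-left , record { children = cs ; rest = I.right ; word-source = source ; word-target = target }
    where
      module X = Occurrence (occurrence-of t₁ pos≡ x≡)
      module I = Occurrence (occurrence-of t₁ (trans pos≡ (sym (++-assoc as (pₓ ∷ []) _))) i≡)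
      I-left : I.left ≡ X.left ++ nothing ∷ []
      I-left = proj₁ (++-cancel-length I.left (X.left ++ nothing ∷ [])
        (trans I.length-left (trans (length-++ as) (trans (cong (_+ 1) (sym X.length-left)) (sym (length-++ X.left)))))
        (trans (sym (I.word-occurrence i≡)) (trans (X.word-occurrence x≡) (sym (++-assoc X.left _ _)))))
      moved : ∀ v → word (replace Sig t₁ pᵢ v) [] ≡ X.left ++ nothing ∷ word v I.right
      moved v = trans (I.word-replace v) (trans (cong (_++ word v I.right) I-left) (++-assoc X.left (nothing ∷ []) (word v I.right)))
      source : word t₁ [] ≡ X.left ++ nothing ∷ just s ∷ wordCh cs I.right
      source = trans (cong (λ t → word t []) (sym (replace-subterm t₁ pᵢ i≡))) (moved (node s cs))
      Y-occ = occurrence (replace Sig t₁ pᵢ leaf) {as} {pₓ} (trans (I.positions-replace leaf) (++-assoc as (pₓ ∷ []) _))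
      module Y = Occurrence (proj₂ (proj₂ Y-occ))
      Y-split : Y.left ≡ X.left × word (proj₁ Y-occ) Y.right ≡ nothing ∷ nothing ∷ I.right
      Y-split = ++-cancel-length Y.left X.left (trans Y.length-left (sym X.length-left))
                  (trans (sym (Y.word-occurrence (proj₁ (proj₂ Y-occ)))) (moved leaf))
      target : word (replace Sig (replace Sig t₁ pᵢ leaf) pₓ (node s cs)) [] ≡ X.left ++ just s ∷ wordCh cs (nothing ∷ I.right)
      target = trans (Y.word-replace (node s cs))
                 (cong₂ (λ α r → α ++ just s ∷ wordCh cs r) (proj₁ Y-split) (proj₂ (word-leaf⁻ _ _ (proj₂ Y-split))))

  nth-split : ∀ {A : Set} (xs : List A) k {x} → nth Sig xs k ≡ just x →
              Σ[ as ∈ List A ] Σ[ ps ∈ List A ] xs ≡ as ++ x ∷ ps × length as ≡ k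
  nth-split (x ∷ xs) zero refl = [] , xs , refl , refl
  nth-split (y ∷ xs) (suc k) eq with nth-split xs k eq
  ... | as , ps , refl , refl = y ∷ as , ps , refl , refl

  nodePos-node : ∀ t i {p u} → nodePos Sig t i ≡ just p → subterm Sig t p ≡ just u →
                 Σ[ s ∈ Sym Sig ] Σ[ cs ∈ Vec (Term Sig) (arity Sig s) ] u ≡ node s cs
  nodePos-node t (suc i) {p} nodePos≡ u≡
    with nth-selectInternal⁻ (word t []) (positions Sig t) i (length-word t)
           (trans (cong (λ ps → nth Sig ps i) (sym (internalPositions-selectInternal t))) nodePos≡)
  ... | k , p-at-k , s , s-at-k with nth-split (positions Sig t) k p-at-k | nth-split (word t []) k s-at-k
  ...   | as , ps , pos≡ , |as|≡k | α , w , word≡ , |α|≡k with subterm-word t pos≡ word≡ (trans |α|≡k (sym |as|≡k))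
  ...     | u′ , u′≡ , r , word-u′≡ with word-node⁻ u′ r word-u′≡
  ...       | cs , refl = s , cs , just-injective (trans (sym u≡) u′≡)

  ⟶[]⇒Rotation : ∀ {t₁ t₂ i} → _⟶[_]_ Sig t₁ i t₂ → Σ[ α ∈ List Letter ] Σ[ s ∈ Sym Sig ] Rotation t₁ t₂ α s
  ⟶[]⇒Rotation {t₁} {i = i} (pₓ , pᵢ , as , bs , u , nodePos≡ , pos≡ , x≡ , i≡ , refl) with nodePos-node t₁ i nodePos≡ i≡
  ... | s , cs , refl = proj₁ rot , s , proj₂ (proj₂ rot)
    where rot = rotation-at t₁ pos≡ x≡ i≡

  private
    leaf-then-node : ∀ t₁ {α s w as pₓ pᵢ bs} → word t₁ [] ≡ α ++ nothing ∷ just s ∷ w →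
      positions Sig t₁ ≡ as ++ pₓ ∷ pᵢ ∷ bs → length as ≡ length α →
      subterm Sig t₁ pₓ ≡ just leaf × Σ[ cs ∈ Vec (Term Sig) (arity Sig s) ] subterm Sig t₁ pᵢ ≡ just (node s cs)
    leaf-then-node t₁ {α} {s} {w} {as} {pₓ} {pᵢ} {bs} word≡ pos≡ |as|≡|α|
      with subterm-word t₁ pos≡ word≡ (sym |as|≡|α|)
         | subterm-word t₁ {as ++ pₓ ∷ []} {α = α ++ nothing ∷ []} (trans pos≡ (sym (++-assoc as (pₓ ∷ []) _)))
             (trans word≡ (sym (++-assoc α (nothing ∷ []) _)))
             (trans (length-++ α) (trans (cong (_+ 1) (sym |as|≡|α|)) (sym (length-++ as))))
    ... | u₀ , x≡ , r₀ , word-u₀ | u₁ , i≡ , r₁ , word-u₁ with word-leaf⁻ u₀ r₀ word-u₀ | word-node⁻ u₁ r₁ word-u₁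
    ...   | refl , _ | cs , refl = x≡ , cs , i≡

    nodePos-after-leaf : ∀ t₁ {α s w as pₓ pᵢ bs} → word t₁ [] ≡ α ++ nothing ∷ just s ∷ w →
      positions Sig t₁ ≡ as ++ pₓ ∷ pᵢ ∷ bs → length as ≡ length α →
      nodePos Sig t₁ (suc (internalCount (α ++ nothing ∷ []))) ≡ just pᵢ
    nodePos-after-leaf t₁ {α} {s} {w} {as} {pₓ} {pᵢ} {bs} word≡ pos≡ |as|≡|α| = begin
      nth Sig (internalPositions Sig t₁) k
        ≡⟨ cong (λ ps → nth Sig ps k) (internalPositions-selectInternal t₁) ⟩
      nth Sig (selectInternal (word t₁ []) (positions Sig t₁)) k
        ≡⟨ cong₂ (λ w′ ps → nth Sig (selectInternal w′ ps) k) (trans word≡ (sym (++-assoc α (nothing ∷ []) _)))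
                                                       (trans pos≡ (sym (++-assoc as (pₓ ∷ []) _))) ⟩
      nth Sig (selectInternal ((α ++ nothing ∷ []) ++ just s ∷ w) ((as ++ pₓ ∷ []) ++ pᵢ ∷ bs)) k
        ≡⟨ nth-selectInternal-internalCount (α ++ nothing ∷ []) (as ++ pₓ ∷ []) w bs s pᵢ
             (trans (length-++ α) (trans (cong (_+ 1) (sym |as|≡|α|)) (sym (length-++ as)))) ⟩
      just pᵢ ∎
      where k = internalCount (α ++ nothing ∷ [])

    leaf-before-node⇒⟶-at : ∀ t₁ {α s w as pₓ pᵢ bs} → word t₁ [] ≡ α ++ nothing ∷ just s ∷ w →
      positions Sig t₁ ≡ as ++ pₓ ∷ pᵢ ∷ bs → length as ≡ length α →
      Σ[ t₂ ∈ Term Sig ] _⟶_ Sig t₁ t₂ × Rotation t₁ t₂ α s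
    leaf-before-node⇒⟶-at t₁ {α} {s} {w} {as} {pₓ} {pᵢ} {bs} word≡ pos≡ |as|≡|α| =
      t₂ , (suc (internalCount (α ++ nothing ∷ [])) , s≤s z≤n , pₓ , pᵢ , as , bs , node s cs
           , nodePos-after-leaf t₁ word≡ pos≡ |as|≡|α| , pos≡ , x≡ , i≡ , refl)
      , subst (λ α′ → Rotation t₁ t₂ α′ s) α′≡α rot
      where
        found : subterm Sig t₁ pₓ ≡ just leaf × Σ[ cs ∈ Vec (Term Sig) (arity Sig s) ] subterm Sig t₁ pᵢ ≡ just (node s cs)
        found = leaf-then-node t₁ word≡ pos≡ |as|≡|α|
        x≡ = proj₁ found
        cs = proj₁ (proj₂ found)
        i≡ = proj₂ (proj₂ found)
        t₂ = replace Sig (replace Sig t₁ pᵢ leaf) pₓ (node s cs)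
        rotated : Σ[ α′ ∈ List Letter ] length α′ ≡ length as × Rotation t₁ t₂ α′ s
        rotated = rotation-at t₁ pos≡ x≡ i≡
        rot = proj₂ (proj₂ rotated)
        α′≡α : proj₁ rotated ≡ α
        α′≡α = proj₁ (++-cancel-length (proj₁ rotated) α (trans (proj₁ (proj₂ rotated)) |as|≡|α|)
                                       (trans (sym (Rotation.word-source rot)) word≡))

  leaf-before-node⇒⟶ : ∀ t₁ α s w → word t₁ [] ≡ α ++ nothing ∷ just s ∷ w →
                       Σ[ t₂ ∈ Term Sig ] _⟶_ Sig t₁ t₂ × Rotation t₁ t₂ α s
  leaf-before-node⇒⟶ t₁ α s w word≡ with split-like (positions Sig t₁) α (trans (sym (length-word t₁)) (cong length word≡))
  ... | as , pₓ , pᵢ , bs , pos≡ , |as|≡|α| = leaf-before-node⇒⟶-at t₁ word≡ pos≡ |as|≡|α|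

  initialStack-word : ∀ t t′ {x w w′} → word t [] ≡ x ∷ w → word t′ [] ≡ x ∷ w′ → initialStack t ≡ initialStack t′
  initialStack-word leaf leaf _ _ = refl
  initialStack-word leaf (node _ _) refl ()
  initialStack-word (node s ts) (node .s ts′) refl refl = refl

  run-children-pop : ∀ m s (cs : Vec (Term Sig) (arity Sig s)) γ κ R n →
    run (wordCh cs (nothing ∷ γ)) (pushChildren m s ++ κ ∷ R) n ≡ run (wordCh cs γ) (pushChildren m s ++ R) n
  run-children-pop m s cs γ κ R n =
    trans (run-wordCh m 1 (arity Sig s) n cs (nothing ∷ γ) (κ ∷ R)) (sym (run-wordCh m 1 (arity Sig s) n cs γ R))

  record StackRaise (t₁ t₂ : Term Sig) (α : List Letter) (s : Sym Sig) : Set where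
    field
      upper lower : Key
      below : List Key
      later : List Label
      stack : stackAfter α (initialStack t₁) 1 ≡ upper ∷ lower ∷ below
      source-labels : labels t₁ ≡ run α (initialStack t₁) 1 ++ (s , lower) ∷ later
      target-labels : labels t₂ ≡ run α (initialStack t₁) 1 ++ (s , upper) ∷ later

    lower<upper : lower <ₖ upper
    lower<upper = All.head (AllPairs.head (subst Descending stack (proj₁ (Invariant-stackAfter α _ 1 (Invariant-initial t₁)))))

  Rotation⇒StackRaise : ∀ {t₁ t₂ α s} → Rotation t₁ t₂ α s → StackRaise t₁ t₂ α s
  Rotation⇒StackRaise {t₁} {α = []} rot with word-leaf⁻ t₁ [] (Rotation.word-source rot)
  ... | refl , ()
  -- The rest of the word starts with a leaf and a node, so two slots are pending.
  Rotation⇒StackRaise {t₁} {t₂} {α = a ∷ α′} {s} rot with stackAfter (a ∷ α′) (initialStack t₁) 1 in stack≡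
                                                   | ForestWord-stackAfter (a ∷ α′) _ (initialStack t₁) 1
                                                       (subst (ForestWord _) word-source (ForestWord-initial t₁))
    where open Rotation rot
  ... | κa ∷ κb ∷ R | _ = record
    { upper = κa ; lower = κb ; below = R ; later = run (wordCh children rest) (pushChildren m s ++ R) (suc m)
    ; stack = stack≡
    ; source-labels = begin
        labels t₁
          ≡⟨ labels-run t₁ ⟩
        run (word t₁ []) st₀ 1
          ≡⟨ cong (λ w → run w st₀ 1) word-source ⟩
        run (α ++ nothing ∷ just s ∷ wordCh children rest) st₀ 1
          ≡⟨ run-++ α _ st₀ 1 ⟩
        run α st₀ 1 ++ run (nothing ∷ just s ∷ wordCh children rest) (stackAfter α st₀ 1) m
          ≡⟨ cong (λ st → run α st₀ 1 ++ run (nothing ∷ just s ∷ wordCh children rest) st m) stack≡ ⟩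
        run α st₀ 1 ++ (s , κb) ∷ run (wordCh children rest) (pushChildren m s ++ R) (suc m) ∎
    ; target-labels = begin
        labels t₂
          ≡⟨ labels-run t₂ ⟩
        run (word t₂ []) (initialStack t₂) 1
          ≡⟨ cong₂ (λ w st → run w st 1) word-target (initialStack-word t₂ t₁ word-target word-source) ⟩
        run (α ++ just s ∷ wordCh children (nothing ∷ rest)) st₀ 1
          ≡⟨ run-++ α _ st₀ 1 ⟩
        run α st₀ 1 ++ run (just s ∷ wordCh children (nothing ∷ rest)) (stackAfter α st₀ 1) m
          ≡⟨ cong (λ st → run α st₀ 1 ++ run (just s ∷ wordCh children (nothing ∷ rest)) st m) stack≡ ⟩
        run α st₀ 1 ++ (s , κa) ∷ run (wordCh children (nothing ∷ rest)) (pushChildren m s ++ κb ∷ R) (suc m)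
          ≡⟨ cong (λ Y → run α st₀ 1 ++ (s , κa) ∷ Y) (run-children-pop m s children rest κb R (suc m)) ⟩
        run α st₀ 1 ++ (s , κa) ∷ run (wordCh children rest) (pushChildren m s ++ R) (suc m) ∎ }
    where
      open Rotation rot
      α = a ∷ α′
      st₀ = initialStack t₁
      m = counterAfter α st₀ 1
  ... | [] | ()
  ... | _ ∷ [] | () ∷ℓ

  _≤ₗ_ : Label → Label → Set
  x ≤ₗ y = proj₁ x ≡ proj₁ y × proj₂ x ≤ₖ proj₂ y

  ≤ₗ-refl : ∀ {x} → x ≤ₗ x
  ≤ₗ-refl = refl , inj₂ refl

  ≤ₗ-antisym : ∀ {x y} → x ≤ₗ y → y ≤ₗ x → x ≡ y
  ≤ₗ-antisym (s≡ , κ≤) (_ , κ≥) = cong₂ _,_ s≡ (≤ₖ-antisym κ≤ κ≥)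

  private
    Pointwise-zip : ∀ {A : Set} {R S : A → A → Set} {xs ys} → Pointwise R xs ys → Pointwise S xs ys →
                    Pointwise (λ x y → R x y × S x y) xs ys
    Pointwise-zip [] [] = []
    Pointwise-zip (r ∷ rs) (s ∷ ss) = (r , s) ∷ Pointwise-zip rs ss

  ⪯⇒≤ₗ : ∀ {t t′} → _⪯_ Sig t t′ → Pointwise _≤ₗ_ (labels t) (labels t′)
  ⪯⇒≤ₗ {t} {t′} (dc≡ , cnc≤) = Pointwise-zip
    (Pointwise.map⁻ proj₁ proj₁ (Pointwise.≡⇒Pointwise-≡ (trans (sym (dc-labels t)) (trans dc≡ (dc-labels t′)))))
    (Pointwise.map⁻ proj₂ proj₂ (Pointwise.map keyValue-cancel-≤ (Pointwise.map⁻ keyValue keyValue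
      (subst₂ (Pointwise ℚ._≤_) (cnc-keys t) (cnc-keys t′) cnc≤))))

  ≤ₗ⇒⪯ : ∀ {t t′} → Pointwise _≤ₗ_ (labels t) (labels t′) → _⪯_ Sig t t′
  ≤ₗ⇒⪯ {t} {t′} le =
    trans (dc-labels t) (trans (Pointwise.Pointwise-≡⇒≡ (Pointwise.map⁺ proj₁ proj₁ (Pointwise.map proj₁ le)))
                               (sym (dc-labels t′)))
    , subst₂ (Pointwise ℚ._≤_) (sym (cnc-keys t)) (sym (cnc-keys t′))
        (Pointwise.map⁺ keyValue keyValue (Pointwise.map keyValue-mono-≤ (Pointwise.map⁺ proj₂ proj₂ (Pointwise.map proj₂ le))))

  ≤ₗ-raise : ∀ I s {κ κ′} Y → κ ≤ₖ κ′ → Pointwise _≤ₗ_ (I ++ (s , κ) ∷ Y) (I ++ (s , κ′) ∷ Y)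
  ≤ₗ-raise I s Y κ≤κ′ = Pointwise.++⁺ (Pointwise.refl ≤ₗ-refl) ((refl , κ≤κ′) ∷ Pointwise.refl ≤ₗ-refl)

  squeeze : ∀ I s {κ κ′} Y {zs} → Pointwise _≤ₗ_ (I ++ (s , κ) ∷ Y) zs → Pointwise _≤ₗ_ zs (I ++ (s , κ′) ∷ Y) →
            Σ[ κ″ ∈ Key ] zs ≡ I ++ (s , κ″) ∷ Y × κ ≤ₖ κ″ × κ″ ≤ₖ κ′
  squeeze [] s Y ((refl , κ≤κ″) ∷ Y≤) ((_ , κ″≤κ′) ∷ Y≥) =
    _ , cong (_ ∷_) (sym (Pointwise.Pointwise-≡⇒≡ (Pointwise.antisymmetric ≤ₗ-antisym Y≤ Y≥))) , κ≤κ″ , κ″≤κ′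
  squeeze (x ∷ I) s Y (x≤z ∷ le) (z≤x ∷ ge) with ≤ₗ-antisym x≤z z≤x | squeeze I s Y le ge
  ... | refl | κ″ , refl , bounds = κ″ , refl , bounds

  record FirstIncrease (xs ys : List Label) : Set where
    field
      prefix : List Label
      symbol : Sym Sig
      lower upper : Key
      rest rest′ : List Label
      source : xs ≡ prefix ++ (symbol , lower) ∷ rest
      target : ys ≡ prefix ++ (symbol , upper) ∷ rest′
      lower<upper : lower <ₖ upper
      rest≤rest′ : Pointwise _≤ₗ_ rest rest′

  first-increase : ∀ {xs ys} → Pointwise _≤ₗ_ xs ys → xs ≢ ys → FirstIncrease xs ys
  first-increase [] xs≢ys = ⊥-elim (xs≢ys refl)
  first-increase {(s , κ) ∷ xs} {_ ∷ ys} ((refl , inj₁ κ<κ′) ∷ le) _ = record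
    { prefix = [] ; symbol = s ; rest = xs ; rest′ = ys ; source = refl ; target = refl ; lower<upper = κ<κ′ ; rest≤rest′ = le }
  first-increase {x ∷ xs} ((refl , inj₂ refl) ∷ le) x∷xs≢ = record
    { prefix = x ∷ prefix ; symbol = symbol ; lower = lower ; upper = upper ; rest = rest ; rest′ = rest′
    ; source = cong (x ∷_) source ; target = cong (x ∷_) target ; lower<upper = lower<upper ; rest≤rest′ = rest≤rest′ }
    where
      r = first-increase le (λ xs≡ys → x∷xs≢ (cong (x ∷_) xs≡ys))
      open FirstIncrease r

  ≺-raise : ∀ {t₁ t₂} I s {κ κ′} Y → labels t₁ ≡ I ++ (s , κ) ∷ Y → labels t₂ ≡ I ++ (s , κ′) ∷ Y →
            κ <ₖ κ′ → _≺_ Sig t₁ t₂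
  ≺-raise {t₁} {t₂} I s Y k₁ k₂ κ<κ′ =
    ≤ₗ⇒⪯ {t₁} {t₂} (subst₂ (Pointwise _≤ₗ_) (sym k₁) (sym k₂) (≤ₗ-raise I s Y (inj₁ κ<κ′)))
    , λ t₁≡t₂ → <ₖ-irrefl (cong proj₂ (∷-injectiveˡ (++-cancelˡ I _ _ (trans (sym k₁) (trans (cong labels t₁≡t₂) k₂)))))
                          κ<κ′

  comparable-≡-dec : ∀ {t t′} → _⪯_ Sig t t′ → Dec (t ≡ t′)
  comparable-≡-dec {t} {t′} t⪯t′ with List.≡-dec _≟ₖ_ (keys t) (keys t′)
  ... | no keys≢ = no (λ t≡t′ → keys≢ (cong keys t≡t′))
  ... | yes keys≡ = yes (labels-injective t t′ (Pointwise.Pointwise-≡⇒≡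
          (Pointwise.map (λ { ((s≡ , _) , κ≡) → cong₂ _,_ s≡ κ≡ })
            (Pointwise-zip (⪯⇒≤ₗ {t} {t′} t⪯t′) (Pointwise.map⁻ proj₂ proj₂ (Pointwise.≡⇒Pointwise-≡ keys≡))))))

  -- Moves are covers

  -- A labelling that agrees with that of t₁ except at the raised node gives it a
  -- key from the replayed stack, on which upper and lower are adjacent.
  stackRaise-intermediate : ∀ {t₁ t₂ α s} (raise : StackRaise t₁ t₂ α s) → let open StackRaise raise in
    ∀ t₃ {κ₃} → dc Sig t₁ ≡ dc Sig t₃ → labels t₃ ≡ run α (initialStack t₁) 1 ++ (s , κ₃) ∷ later →
    lower ≤ₖ κ₃ → κ₃ ≤ₖ upper → κ₃ ≡ upper ⊎ κ₃ ≡ lower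
  stackRaise-intermediate {t₁} {α = α} {s} raise t₃ {κ₃} dc≡ k₃ lower≤κ₃ κ₃≤upper =
    between-neighbours M (subst Descending replay≡ desc) (subst (κ₃ ∈_) replay≡ κ₃∈) lower≤κ₃ κ₃≤upper
    where
      open StackRaise raise
      st₀ = initialStack t₁
      run₃ : run (word t₃ []) st₀ 1 ≡ run α st₀ 1 ++ (s , κ₃) ∷ later
      run₃ = trans (cong (λ st → run (word t₃ []) st 1) (initialStack-dc t₁ t₃ dc≡)) (trans (sym (labels-run t₃)) k₃)
      replayed = emitted-key-replayed (word t₃ []) st₀ 1 (run α st₀ 1) (Invariant-initial t₁) run₃
      desc = proj₁ replayed
      κ₃∈ = proj₂ replayed
      M = proj₁ (replay-run α st₀ 1 (Invariant-initial t₁))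
      replay≡ : replay st₀ 1 (run α st₀ 1) ≡ M ++ upper ∷ lower ∷ below
      replay≡ = trans (proj₂ (replay-run α st₀ 1 (Invariant-initial t₁))) (cong (M ++_) stack)

  stackRaise-no-between : ∀ {t₁ t₂ α s} → StackRaise t₁ t₂ α s → ¬ (∃[ t₃ ] (_≺_ Sig t₁ t₃ × _≺_ Sig t₃ t₂))
  stackRaise-no-between {t₁} {t₂} {α} {s} raise (t₃ , (t₁⪯t₃ , t₁≢t₃) , (t₃⪯t₂ , t₃≢t₂))
    with squeeze (run α (initialStack t₁) 1) s (StackRaise.later raise)
           (subst₂ (Pointwise _≤ₗ_) (StackRaise.source-labels raise) refl (⪯⇒≤ₗ {t₁} {t₃} t₁⪯t₃))
           (subst₂ (Pointwise _≤ₗ_) refl (StackRaise.target-labels raise) (⪯⇒≤ₗ {t₃} {t₂} t₃⪯t₂))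
  ... | κ₃ , k₃ , lower≤κ₃ , κ₃≤upper with stackRaise-intermediate raise t₃ (proj₁ t₁⪯t₃) k₃ lower≤κ₃ κ₃≤upper
  ...   | inj₁ refl = t₃≢t₂ (labels-injective t₃ t₂ (trans k₃ (sym (StackRaise.target-labels raise))))
  ...   | inj₂ refl = t₁≢t₃ (labels-injective t₁ t₃ (trans (StackRaise.source-labels raise) (sym k₃)))

  ⟶⇒Covers : ∀ {t₁ t₂} → _⟶_ Sig t₁ t₂ → Covers Sig t₁ t₂
  ⟶⇒Covers {t₁} {t₂} (i , _ , step) =
    ≺-raise (run α (initialStack t₁) 1) s later source-labels target-labels lower<upper , stackRaise-no-between raise
    where
      rotated = ⟶[]⇒Rotation {i = i} step
      α = proj₁ rotated
      s = proj₁ (proj₂ rotated)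
      raise : StackRaise t₁ t₂ α s
      raise = Rotation⇒StackRaise (proj₂ (proj₂ rotated))
      open StackRaise raise

  -- Covers are moves

  -- A leaf read just before the node that takes the slot key κ, whose own slot
  -- key is at most κ′; moving it past that node′s subterm gives the node this key.
  record RaisableLeaf (t : Term Sig) (I : List Label) (s : Sym Sig) (κ κ′ : Key) : Set where
    field
      before : List Letter
      after : List Letter
      key : Key
      others : List Key
      word-split : word t [] ≡ before ++ nothing ∷ just s ∷ after
      run-before : run before (initialStack t) 1 ≡ I
      stack-before : stackAfter before (initialStack t) 1 ≡ key ∷ κ ∷ others
      key≤κ′ : key ≤ₖ κ′

  raisable-leaf : ∀ {t₁ t₂} → dc Sig t₁ ≡ dc Sig t₂ → (r : FirstIncrease (labels t₁) (labels t₂)) →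
    let open FirstIncrease r in RaisableLeaf t₁ prefix symbol lower upper
  raisable-leaf {t₁} {t₂} dc≡ r = record
    { before = proj₁ skipped ; after = proj₁ (proj₂ skipped) ; key = l ; others = Loc.below
    ; word-split = proj₁ (proj₂ (proj₂ skipped)) ; run-before = proj₁ (proj₂ (proj₂ (proj₂ skipped)))
    ; stack-before = proj₂ (proj₂ (proj₂ (proj₂ skipped))) ; key≤κ′ = proj₂ (proj₂ (proj₂ last)) }
    where
      open FirstIncrease r
      st₀ = initialStack t₁
      run₁ : run (word t₁ []) st₀ 1 ≡ prefix ++ (symbol , lower) ∷ rest
      run₁ = trans (sym (labels-run t₁)) source
      run₂ : run (word t₂ []) st₀ 1 ≡ prefix ++ (symbol , upper) ∷ rest′
      run₂ = trans (cong (λ st → run (word t₂ []) st 1) (initialStack-dc t₁ t₂ dc≡)) (trans (sym (labels-run t₂)) target)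
      loc : Located (word t₁ []) st₀ 1 prefix symbol lower
      loc = locate (word t₁ []) st₀ 1 prefix (Invariant-initial t₁) run₁
      module Loc = Located loc
      desc : Descending (Loc.above ++ lower ∷ Loc.below)
      desc = subst Descending Loc.replay-split
               (proj₁ (emitted-key-replayed (word t₁ []) st₀ 1 prefix (Invariant-initial t₁) run₁))
      upper∈ : upper ∈ Loc.above ++ lower ∷ Loc.below
      upper∈ = subst (upper ∈_) Loc.replay-split
                 (proj₂ (emitted-key-replayed (word t₂ []) st₀ 1 prefix (Invariant-initial t₁) run₂))
      last : Σ[ L′ ∈ List Key ] Σ[ l ∈ Key ] Loc.above ≡ L′ ++ l ∷ [] × l ≤ₖ upper
      last = last-above Loc.above desc upper∈ lower<upper
      l = proj₁ (proj₂ last)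
      skipped = skip-leaves loc (proj₁ last) l (proj₁ (proj₂ (proj₂ last)))

  first-increase-move : ∀ {t₁ t₂} → dc Sig t₁ ≡ dc Sig t₂ → FirstIncrease (labels t₁) (labels t₂) →
    Σ[ t′ ∈ Term Sig ] _⟶_ Sig t₁ t′ × Pointwise _≤ₗ_ (labels t′) (labels t₂)
  first-increase-move {t₁} {t₂} dc≡ r =
    proj₁ moved , proj₁ (proj₂ moved)
    , subst₂ (Pointwise _≤ₗ_) (sym labels′) (sym target)
        (Pointwise.++⁺ (Pointwise.refl ≤ₗ-refl) ((refl , key≤κ′) ∷ rest≤rest′))
    where
      open FirstIncrease r
      open RaisableLeaf (raisable-leaf {t₁} {t₂} dc≡ r)
      moved = leaf-before-node⇒⟶ t₁ before symbol after word-split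
      module K = StackRaise (Rotation⇒StackRaise (proj₂ (proj₂ moved)))
      stacks : K.upper ∷ K.lower ∷ K.below ≡ key ∷ lower ∷ others
      stacks = trans (sym K.stack) stack-before
      later≡rest : K.later ≡ rest
      later≡rest = ∷-injectiveʳ (++-cancelˡ prefix _ _ (begin
        prefix ++ (symbol , K.lower) ∷ K.later
          ≡⟨ cong (_++ (symbol , K.lower) ∷ K.later) (sym run-before) ⟩
        run before (initialStack t₁) 1 ++ (symbol , K.lower) ∷ K.later
          ≡⟨ sym K.source-labels ⟩
        labels t₁
          ≡⟨ source ⟩
        prefix ++ (symbol , lower) ∷ rest ∎))
      labels′ : labels (proj₁ moved) ≡ prefix ++ (symbol , key) ∷ rest
      labels′ = begin
        labels (proj₁ moved)
          ≡⟨ K.target-labels ⟩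
        run before (initialStack t₁) 1 ++ (symbol , K.upper) ∷ K.later
          ≡⟨ cong₂ (λ κ Y → run before (initialStack t₁) 1 ++ (symbol , κ) ∷ Y) (∷-injectiveˡ stacks) later≡rest ⟩
        run before (initialStack t₁) 1 ++ (symbol , key) ∷ rest
          ≡⟨ cong (_++ (symbol , key) ∷ rest) run-before ⟩
        prefix ++ (symbol , key) ∷ rest ∎

  ≺⇒⟶⪯ : ∀ {t₁ t₂} → _≺_ Sig t₁ t₂ → Σ[ t′ ∈ Term Sig ] _⟶_ Sig t₁ t′ × _⪯_ Sig t′ t₂
  ≺⇒⟶⪯ {t₁} {t₂} (t₁⪯t₂ , t₁≢t₂) =
    proj₁ moved , proj₁ (proj₂ moved) , ≤ₗ⇒⪯ {proj₁ moved} {t₂} (proj₂ (proj₂ moved))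
    where
      moved = first-increase-move {t₁} {t₂} (proj₁ t₁⪯t₂)
                (first-increase (⪯⇒≤ₗ {t₁} {t₂} t₁⪯t₂) (λ labels≡ → t₁≢t₂ (labels-injective t₁ t₂ labels≡)))

  covering-squeeze : ∀ {t₁ t₂ t′} → Covers Sig t₁ t₂ → _≺_ Sig t₁ t′ → _⪯_ Sig t′ t₂ → t′ ≡ t₂
  covering-squeeze {t′ = t′} (_ , no-between) t₁≺t′ t′⪯t₂ with comparable-≡-dec {t′} t′⪯t₂
  ... | yes t′≡t₂ = t′≡t₂
  ... | no t′≢t₂ = ⊥-elim (no-between (t′ , t₁≺t′ , t′⪯t₂ , t′≢t₂))

  Covers⇒⟶ : ∀ {t₁ t₂} → Covers Sig t₁ t₂ → _⟶_ Sig t₁ t₂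
  Covers⇒⟶ {t₁} {t₂} cover =
    subst (_⟶_ Sig t₁) (covering-squeeze {t₁} {t₂} {t′} cover t₁≺t′ (proj₂ (proj₂ moved))) step
    where
      moved : Σ[ t′ ∈ Term Sig ] _⟶_ Sig t₁ t′ × _⪯_ Sig t′ t₂
      moved = ≺⇒⟶⪯ {t₁} {t₂} (proj₁ cover)
      t′ = proj₁ moved
      step : _⟶_ Sig t₁ t′
      step = proj₁ (proj₂ moved)
      t₁≺t′ : _≺_ Sig t₁ t′
      t₁≺t′ = proj₁ (⟶⇒Covers {t₁} {t′} step)

theorem2p2p9 : (Sig : Signature) (t₁ t₂ : Term Sig) →
    ((_⟶_ Sig t₁ t₂ → Covers Sig t₁ t₂) × (Covers Sig t₁ t₂ → _⟶_ Sig t₁ t₂))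
theorem2p2p9 Sig t₁ t₂ = ⟶⇒Covers Sig , Covers⇒⟶ Sig
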